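{- Let $m,d\in\mathbb{N}$, $a>0$, $b\in(0,\frac{a}{2d})$ and $c\in\left(0,2b\left(\frac{a}{2d}-b\right)\right)$. There exists $n_0$ such that for every set $V$ with $|V|=n\ge n_0$ the following holds. For every $S\in\binom{V}{m}$ let $f(S)$ be a subset of $V^d$, and call $T\in V^d$ a good tuple if $T\in f(S)$ for some $S\in\binom{V}{m}$. If $|f(S)|\ge an^d$ for every $S\in\binom{V}{m}$, then there exists a set $\mathcal{F}$ of at most $bn/d$ good tuples such that $|f(S)\cap\mathcal{F}|\ge cn$ for every $S\in\binom{V}{m}$ and the images of distinct elements of $\mathcal{F}$ are disjoint.
   Context: For a tuple $T=(t_1,\dots,t_d)\in V^d$, its image is the set $\{t_1,\dots,t_d\}$. $\binom{V}{m}$ denotes the family of $m$-element subsets of $V$.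
   Formalization: The parameters a, b and c are rational. -}

module Defs where

open import Data.Nat using (ℕ; zero; suc; NonZero)
open import Data.Integer using (+_)
open import Data.Rational using (ℚ; _/_; _*_)
open import Data.Fin using (Fin)
open import Data.Fin.Subset using (Subset)
open import Data.Vec using (Vec; []; _∷_)
open import Data.List using (List; [_]; map; concatMap; allFin; filter; length)
open import Data.Bool using (Bool; true)
open import Data.Product using (Σ; _×_)
open import Relation.Binary.PropositionalEquality using (_≡_)
open import Data.Bool.Properties using (T?)
open import Data.Bool using (T)

⟦_⟧ : ℕ → ℚ
⟦ k ⟧ = + k / 1

_÷ℕ_ : ℚ → (k : ℕ) → .{{NonZero k}} → ℚ
q ÷ℕ k = q * (+ 1 / k)

-- V^d with V = Fin n : d-tuples of vertices
Tuple : ℕ → ℕ → Set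
Tuple n d = Vec (Fin n) d

allTuples : (n d : ℕ) → List (Tuple n d)
allTuples n zero = [ [] ]
allTuples n (suc d) = concatMap (λ i → map (i ∷_) (allTuples n d)) (allFin n)

TupleSet : ℕ → ℕ → Set
TupleSet n d = Tuple n d → Bool

card : {n d : ℕ} → TupleSet n d → ℕ
card {n} {d} A = length (filter (λ t → T? (A t)) (allTuples n d))

-- |A ∩ F| for a list F of (pairwise distinct) tuples
cardIn : {n d : ℕ} → TupleSet n d → List (Tuple n d) → ℕ
cardIn A F = length (filter (λ t → T? (A t)) F)

module Submission where

-- A derandomised greedy packing.  Candidate tuples are scanned one at a time; a candidate is kept
-- if it lies in some f(S) and its image avoids the images of the tuples kept so far.  At most
-- b n / d tuples are kept, and they block at most d b n^d tuples, so every f(S) still offers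
-- (a - d b) n^d candidates that would be kept and counted for S.  Each candidate is chosen by the
-- method of conditional expectations for the potential Σ_S Π (M - [the candidate is kept and lies
-- in f(S)]): a below-average choice makes the potential shrink by a factor 1 - (a - d b) / M per
-- step, whereas a set S with fewer than c n kept tuples alone contributes a factor (1 - 1/M)^(c n).
-- For large M the condition d (c + b²) < a b, implied by the hypothesis on c, makes the former
-- exponentially smaller than the latter, which beats the initial potential n^m once n is large.

module FiniteSums where

  open import Data.Bool using (Bool; true; false)
  open import Data.Bool.Properties using (T?)
  open import Data.List using (List; []; _∷_; _++_; map; concatMap; filter; length)
  open import Data.List.Membership.Propositional using (_∈_)
  open import Data.List.Relation.Unary.Any using (here; there)
  open import Data.Nat
  open import Data.Nat.Properties
  import Algebra.Properties.CommutativeSemigroup +-commutativeSemigroup as +-CS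
  open import Data.Product using (∃; _,_)
  open import Function using (_∘_)
  open import Relation.Binary.PropositionalEquality
  open import Relation.Nullary using (yes; no)

  𝟙 : Bool → ℕ
  𝟙 true = 1
  𝟙 false = 0

  𝟙≤1 : ∀ b → 𝟙 b ≤ 1
  𝟙≤1 true = ≤-refl
  𝟙≤1 false = z≤n

  ∑ : {A : Set} → List A → (A → ℕ) → ℕ
  ∑ [] h = 0
  ∑ (x ∷ xs) h = h x + ∑ xs h

  syntax ∑ xs (λ x → e) = ∑[ x ∈ xs ] e

  private
    variable
      A B : Set

  ∑-++ : (xs ys : List A) (h : A → ℕ) → ∑ (xs ++ ys) h ≡ ∑ xs h + ∑ ys h
  ∑-++ [] ys h = refl
  ∑-++ (x ∷ xs) ys h = trans (cong (h x +_) (∑-++ xs ys h)) (sym (+-assoc (h x) _ _))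

  ∑-map : (g : A → B) (xs : List A) (h : B → ℕ) → ∑ (map g xs) h ≡ ∑ xs (h ∘ g)
  ∑-map g [] h = refl
  ∑-map g (x ∷ xs) h = cong (h (g x) +_) (∑-map g xs h)

  ∑-concatMap : (g : A → List B) (xs : List A) (h : B → ℕ) →
                ∑ (concatMap g xs) h ≡ ∑[ x ∈ xs ] ∑ (g x) h
  ∑-concatMap g [] h = refl
  ∑-concatMap g (x ∷ xs) h =
    trans (∑-++ (g x) (concatMap g xs) h) (cong (∑ (g x) h +_) (∑-concatMap g xs h))

  ∑-cong : (xs : List A) {h k : A → ℕ} → (∀ x → h x ≡ k x) → ∑ xs h ≡ ∑ xs k
  ∑-cong [] e = refl
  ∑-cong (x ∷ xs) e = cong₂ _+_ (e x) (∑-cong xs e)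

  ∑-mono-≤ : (xs : List A) {h k : A → ℕ} → (∀ x → h x ≤ k x) → ∑ xs h ≤ ∑ xs k
  ∑-mono-≤ [] e = z≤n
  ∑-mono-≤ (x ∷ xs) e = +-mono-≤ (e x) (∑-mono-≤ xs e)

  ∑-distrib-+ : (xs : List A) (h k : A → ℕ) → ∑[ x ∈ xs ] (h x + k x) ≡ ∑ xs h + ∑ xs k
  ∑-distrib-+ [] h k = refl
  ∑-distrib-+ (x ∷ xs) h k =
    trans (cong (h x + k x +_) (∑-distrib-+ xs h k)) (+-CS.interchange (h x) (k x) (∑ xs h) (∑ xs k))

  ∑-distribˡ-* : (xs : List A) (c : ℕ) (h : A → ℕ) → ∑[ x ∈ xs ] (c * h x) ≡ c * ∑ xs h
  ∑-distribˡ-* [] c h = sym (*-zeroʳ c)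
  ∑-distribˡ-* (x ∷ xs) c h = trans (cong (c * h x +_) (∑-distribˡ-* xs c h)) (sym (*-distribˡ-+ c (h x) _))

  ∑-const : (xs : List A) (c : ℕ) → ∑[ _ ∈ xs ] c ≡ length xs * c
  ∑-const [] c = refl
  ∑-const (x ∷ xs) c = cong (c +_) (∑-const xs c)

  ∑-zero : (xs : List A) → ∑[ _ ∈ xs ] 0 ≡ 0
  ∑-zero xs = trans (∑-const xs 0) (*-zeroʳ (length xs))

  ∑-comm : (xs : List A) (ys : List B) (h : A → B → ℕ) →
           ∑[ x ∈ xs ] ∑ ys (h x) ≡ ∑[ y ∈ ys ] ∑[ x ∈ xs ] h x y
  ∑-comm [] ys h = sym (∑-zero ys)
  ∑-comm (x ∷ xs) ys h =
    trans (cong (∑ ys (h x) +_) (∑-comm xs ys h)) (sym (∑-distrib-+ ys (h x) (λ y → ∑[ x′ ∈ xs ] h x′ y)))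

  ∈⇒≤∑ : {xs : List A} {x : A} (h : A → ℕ) → x ∈ xs → h x ≤ ∑ xs h
  ∈⇒≤∑ h (here refl) = m≤m+n _ _
  ∈⇒≤∑ {xs = y ∷ _} h (there x∈xs) = ≤-trans (∈⇒≤∑ h x∈xs) (m≤n+m _ (h y))

  ∃-below-average : (xs : List A) (h : A → ℕ) → 0 < length xs → ∃ λ x → h x * length xs ≤ ∑ xs h
  ∃-below-average (x ∷ []) h _ = x , ≤-reflexive (trans (*-identityʳ (h x)) (sym (+-identityʳ (h x))))
  ∃-below-average (x ∷ xs@(_ ∷ _)) h _ with ∃-below-average xs h (s≤s z≤n)
  ... | y , hy with h x ≤? h y
  ...   | yes hx≤hy = x , ≤-trans (≤-reflexive (*-suc (h x) _)) (+-monoʳ-≤ (h x) (≤-trans (*-monoˡ-≤ _ hx≤hy) hy))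
  ...   | no hx≰hy = y , ≤-trans (≤-reflexive (*-suc (h y) _)) (+-mono-≤ (<⇒≤ (≰⇒> hx≰hy)) hy)

  length-filter≡∑𝟙 : (xs : List A) (p : A → Bool) → length (filter (λ x → T? (p x)) xs) ≡ ∑[ x ∈ xs ] 𝟙 (p x)
  length-filter≡∑𝟙 [] p = refl
  length-filter≡∑𝟙 (x ∷ xs) p with p x
  ... | true = cong suc (length-filter≡∑𝟙 xs p)
  ... | false = length-filter≡∑𝟙 xs p

module Enumeration where

  open import Data.Bool using (Bool; true; false)
  open import Data.Fin using (Fin; zero; suc; toℕ)
  open import Data.Fin.Subset using (Subset; ∣_∣)
  open import Data.List using (List; []; _∷_; _++_; map; concatMap; allFin; length)
  open import Data.List.Properties using (map-tabulate; length-tabulate)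
  open import Data.List.Membership.Propositional using (_∈_)
  open import Data.List.Membership.Propositional.Properties using (∈-++⁺ˡ; ∈-++⁺ʳ; ∈-map⁺)
  open import Data.List.Relation.Unary.Any using (here)
  open import Data.Nat
  open import Data.Nat.Properties
  open import Data.Vec using ([]; _∷_; lookup)
  open import Function using (id)
  open import Relation.Binary.PropositionalEquality

  open import Defs
  open FiniteSums

  infix 4 _==_
  _==_ : {n : ℕ} → Fin n → Fin n → Bool
  u == i = toℕ u ≡ᵇ toℕ i

  length-allFin : (n : ℕ) → length (allFin n) ≡ n
  length-allFin n = length-tabulate id

  ∑-allFin-suc : {n : ℕ} (h : Fin (suc n) → ℕ) → ∑ (allFin (suc n)) h ≡ h zero + ∑[ i ∈ allFin n ] h (suc i)
  ∑-allFin-suc {n} h = cong (h zero +_) (trans (cong (λ is → ∑ is h) (sym (map-tabulate id suc))) (∑-map suc (allFin n) h))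

  ∑-allFin-== : {n : ℕ} (u : Fin n) → ∑[ i ∈ allFin n ] 𝟙 (i == u) ≡ 1
  ∑-allFin-== {suc n} zero = trans (∑-allFin-suc {n} (λ i → 𝟙 (i == zero))) (cong suc (∑-zero (allFin n)))
  ∑-allFin-== {suc n} (suc u) = trans (∑-allFin-suc (λ i → 𝟙 (i == suc u))) (∑-allFin-== {n} u)

  ∑-allFin-const : (n c : ℕ) → ∑[ _ ∈ allFin n ] c ≡ n * c
  ∑-allFin-const n c = trans (∑-const (allFin n) c) (cong (_* c) (length-allFin n))

  ∑-allTuples : (n d : ℕ) (h : Tuple n (suc d) → ℕ) →
                ∑ (allTuples n (suc d)) h ≡ ∑[ i ∈ allFin n ] ∑[ τ ∈ allTuples n d ] h (i ∷ τ)
  ∑-allTuples n d h = trans (∑-concatMap _ (allFin n) h) (∑-cong (allFin n) (λ i → ∑-map (i ∷_) (allTuples n d) h))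

  length-allTuples : (n d : ℕ) → length (allTuples n d) ≡ n ^ d
  length-allTuples n zero = refl
  length-allTuples n (suc d) = begin
    length (allTuples n (suc d))                 ≡⟨ sym (trans (∑-const (allTuples n (suc d)) 1) (*-identityʳ _)) ⟩
    ∑[ _ ∈ allTuples n (suc d) ] 1               ≡⟨ ∑-allTuples n d _ ⟩
    ∑[ _ ∈ allFin n ] ∑[ _ ∈ allTuples n d ] 1   ≡⟨ ∑-cong (allFin n) (λ _ → trans (∑-const (allTuples n d) 1) (*-identityʳ _)) ⟩
    ∑[ _ ∈ allFin n ] length (allTuples n d)     ≡⟨ ∑-allFin-const n _ ⟩
    n * length (allTuples n d)                   ≡⟨ cong (n *_) (length-allTuples n d) ⟩
    n ^ suc d                                    ∎
    where open ≡-Reasoning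

  -- n ^ (d - 1) tuples, stated without the truncated subtraction d - 1.
  count-lookup-== : (n d : ℕ) (u : Fin n) (k : Fin d) →
                  n * ∑[ τ ∈ allTuples n d ] 𝟙 (lookup τ k == u) ≡ n ^ d
  count-lookup-== n (suc d) u zero = cong (n *_) (begin
    ∑[ τ ∈ allTuples n (suc d) ] 𝟙 (lookup τ zero == u)        ≡⟨ ∑-allTuples n d _ ⟩
    ∑[ i ∈ allFin n ] ∑[ τ ∈ allTuples n d ] 𝟙 (i == u)       ≡⟨ ∑-cong (allFin n) (λ i → ∑-const (allTuples n d) _) ⟩
    ∑[ i ∈ allFin n ] (length (allTuples n d) * 𝟙 (i == u))  ≡⟨ ∑-distribˡ-* (allFin n) (length (allTuples n d)) (λ i → 𝟙 (i == u)) ⟩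
    length (allTuples n d) * ∑[ i ∈ allFin n ] 𝟙 (i == u)    ≡⟨ cong₂ _*_ (length-allTuples n d) (∑-allFin-== u) ⟩
    n ^ d * 1                                                    ≡⟨ *-identityʳ _ ⟩
    n ^ d                                                        ∎)
    where open ≡-Reasoning
  count-lookup-== n (suc d) u (suc k) = cong (n *_) (begin
    ∑[ τ ∈ allTuples n (suc d) ] 𝟙 (lookup τ (suc k) == u)       ≡⟨ ∑-allTuples n d _ ⟩
    ∑[ i ∈ allFin n ] ∑[ τ ∈ allTuples n d ] 𝟙 (lookup τ k == u)  ≡⟨ ∑-allFin-const n _ ⟩
    n * ∑[ τ ∈ allTuples n d ] 𝟙 (lookup τ k == u)                ≡⟨ count-lookup-== n d u k ⟩
    n ^ d                                                            ∎)
    where open ≡-Reasoning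

  allSubsets : (n : ℕ) → List (Subset n)
  allSubsets zero = [] ∷ []
  allSubsets (suc n) = map (true ∷_) (allSubsets n) ++ map (false ∷_) (allSubsets n)

  ∈-allSubsets : (n : ℕ) (S : Subset n) → S ∈ allSubsets n
  ∈-allSubsets zero [] = here refl
  ∈-allSubsets (suc n) (true ∷ S) = ∈-++⁺ˡ (∈-map⁺ (true ∷_) (∈-allSubsets n S))
  ∈-allSubsets (suc n) (false ∷ S) = ∈-++⁺ʳ _ (∈-map⁺ (false ∷_) (∈-allSubsets n S))

  -- binomial(n, m) ≤ n ^ m, by Pascal's rule.
  subsets-of-size-≤ : (n m : ℕ) → ∑[ S ∈ allSubsets n ] 𝟙 (∣ S ∣ ≡ᵇ m) ≤ n ^ m
  subsets-of-size-≤ zero zero = ≤-refl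
  subsets-of-size-≤ zero (suc m) = z≤n
  subsets-of-size-≤ (suc n) m = begin
    ∑[ S ∈ allSubsets (suc n) ] 𝟙 (∣ S ∣ ≡ᵇ m)
      ≡⟨ ∑-++ (map (true ∷_) (allSubsets n)) _ _ ⟩
    ∑ (map (true ∷_) (allSubsets n)) size≡m + ∑ (map (false ∷_) (allSubsets n)) size≡m
      ≡⟨ cong₂ _+_ (∑-map (true ∷_) (allSubsets n) size≡m) (∑-map (false ∷_) (allSubsets n) size≡m) ⟩
    ∑[ S ∈ allSubsets n ] 𝟙 (suc ∣ S ∣ ≡ᵇ m) + ∑[ S ∈ allSubsets n ] 𝟙 (∣ S ∣ ≡ᵇ m)
      ≤⟨ split m ⟩
    suc n ^ m ∎
    where
    open ≤-Reasoning
    size≡m : Subset (suc n) → ℕ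
    size≡m S = 𝟙 (∣ S ∣ ≡ᵇ m)
    split : ∀ m → ∑[ S ∈ allSubsets n ] 𝟙 (suc ∣ S ∣ ≡ᵇ m) + ∑[ S ∈ allSubsets n ] 𝟙 (∣ S ∣ ≡ᵇ m) ≤ suc n ^ m
    split zero = ≤-trans (≤-reflexive (cong (_+ ∑[ S ∈ allSubsets n ] 𝟙 (∣ S ∣ ≡ᵇ 0)) (∑-zero (allSubsets n)))) (subsets-of-size-≤ n zero)
    split (suc m) = +-mono-≤ (≤-trans (subsets-of-size-≤ n m) (^-monoˡ-≤ m (n≤1+n n)))
                             (≤-trans (subsets-of-size-≤ n (suc m)) (*-monoʳ-≤ n (^-monoˡ-≤ m (n≤1+n n))))

module Greedy where

  open import Data.Bool using (Bool; true; false; not; _∧_; if_then_else_; T)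
  open import Data.Bool.Properties using (T-≡; T-∧; T-not-≡; ∧-identityʳ; ∧-zeroʳ)
  open import Data.Fin using (Fin; zero; suc; toℕ)
  open import Data.Fin.Subset using (Subset; ∣_∣)
  open import Data.Bool.ListAction using (any)
  open import Data.List using (List; []; _∷_; length; allFin) renaming (lookup to lookupL)
  open import Data.List.Membership.Propositional using (_∈_)
  open import Data.List.Membership.Propositional.Properties using (∈-allFin; ∈-lookup)
  open import Data.List.Relation.Unary.All as All using (All)
  open import Data.List.Relation.Unary.All.Properties using (¬Any⇒All¬)
  open import Data.List.Relation.Unary.AllPairs using (AllPairs; []; _∷_)
  open import Data.List.Relation.Unary.Any as Any using (Any; here; there)
  open import Data.List.Relation.Unary.Any.Properties using (any⁺; any⁻)
  open import Data.Nat
  open import Data.Nat.Properties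
  import Algebra.Properties.CommutativeSemigroup *-commutativeSemigroup as *-CS
  open import Data.Product using (∃-syntax; _×_; _,_; proj₁; proj₂)
  open import Data.Vec using (lookup)
  open import Function using (_∘_)
  open import Function.Bundles using (Equivalence)
  open import Relation.Binary.PropositionalEquality
  open import Relation.Nullary using (¬_; contradiction)
  open import Data.Nat.Tactic.RingSolver using (solve-∀)

  open import Defs
  open FiniteSums
  open Enumeration

  open Equivalence using (to; from)

  𝟙-any-≤ : {A : Set} (p : A → Bool) (xs : List A) → 𝟙 (any p xs) ≤ ∑[ x ∈ xs ] 𝟙 (p x)
  𝟙-any-≤ p [] = z≤n
  𝟙-any-≤ p (x ∷ xs) with p x
  ... | true = s≤s z≤n
  ... | false = 𝟙-any-≤ p xs

  ==-refl : {n : ℕ} (u : Fin n) → T (u == u)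
  ==-refl u = ≡⇒≡ᵇ (toℕ u) (toℕ u) refl

  AllPairs-lookup : {A : Set} {R : A → A → Set} → (∀ {x y} → R x y → R y x) → {xs : List A} → AllPairs R xs →
                    (i j : Fin (length xs)) → i ≢ j → R (lookupL xs i) (lookupL xs j)
  AllPairs-lookup R-sym (px ∷ pxs) zero zero i≢j = contradiction refl i≢j
  AllPairs-lookup R-sym (px ∷ pxs) zero (suc j) _ = All.lookup px (∈-lookup j)
  AllPairs-lookup R-sym (px ∷ pxs) (suc i) zero _ = R-sym (All.lookup px (∈-lookup i))
  AllPairs-lookup R-sym (px ∷ pxs) (suc i) (suc j) i≢j = AllPairs-lookup R-sym pxs i j (i≢j ∘ cong suc)

  Disjoint : {n d : ℕ} → Tuple n d → Tuple n d → Set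
  Disjoint τ t = ∀ k l → lookup τ k ≢ lookup t l

  module GreedyPacking {n d : ℕ} (m : ℕ) (f : Subset n → TupleSet n d) where

    hasSize : Subset n → Bool
    hasSize S = ∣ S ∣ ≡ᵇ m

    good : TupleSet n d
    good τ = any (λ S → hasSize S ∧ f S τ) (allSubsets n)

    meets : Tuple n d → Tuple n d → Bool
    meets τ t = any (λ k → any (λ l → lookup τ k == lookup t l) (allFin d)) (allFin d)

    clashes : Tuple n d → List (Tuple n d) → Bool
    clashes τ = any (meets τ)

    admissible : Tuple n d → List (Tuple n d) → Bool
    admissible τ F = not (clashes τ F) ∧ good τ

    -- The candidate list is scanned from its last element to its first.
    greedy : List (Tuple n d) → List (Tuple n d)
    greedy [] = []
    greedy (τ ∷ σ) = if admissible τ (greedy σ) then τ ∷ greedy σ else greedy σ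

    length-greedy-≤ : (σ : List (Tuple n d)) → length (greedy σ) ≤ length σ
    length-greedy-≤ [] = z≤n
    length-greedy-≤ (τ ∷ σ) with admissible τ (greedy σ)
    ... | true = s≤s (length-greedy-≤ σ)
    ... | false = m≤n⇒m≤1+n (length-greedy-≤ σ)

    good⇒witness : (τ : Tuple n d) → T (good τ) → ∃[ S ] (∣ S ∣ ≡ m × f S τ ≡ true)
    good⇒witness τ goodτ = witness (any⁻ _ (allSubsets n) goodτ)
      where
      witness : {Ss : List (Subset n)} → Any (T ∘ λ S → hasSize S ∧ f S τ) Ss → ∃[ S ] (∣ S ∣ ≡ m × f S τ ≡ true)
      witness (there p) = witness p
      witness {S ∷ _} (here p) with to T-∧ p
      ... | size , fSτ = S , ≡ᵇ⇒≡ _ _ size , to T-≡ fSτ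

    witness⇒good : (S : Subset n) (τ : Tuple n d) → ∣ S ∣ ≡ m → f S τ ≡ true → T (good τ)
    witness⇒good S τ refl fSτ = any⁺ _ (Any.map (λ { refl → sized }) (∈-allSubsets n S))
      where
      sized : T (hasSize S ∧ f S τ)
      sized = from T-∧ (≡⇒≡ᵇ ∣ S ∣ ∣ S ∣ refl , from T-≡ fSτ)

    greedy-good : (σ : List (Tuple n d)) (t : Tuple n d) → t ∈ greedy σ → ∃[ S ] (∣ S ∣ ≡ m × f S t ≡ true)
    greedy-good (τ ∷ σ) t t∈ with admissible τ (greedy σ) in eq
    greedy-good (τ ∷ σ) t (here refl) | true = good⇒witness τ (proj₂ (to T-∧ (from T-≡ eq)))
    greedy-good (τ ∷ σ) t (there t∈) | true = greedy-good σ t t∈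
    ... | false = greedy-good σ t t∈

    ¬meets⇒Disjoint : (τ t : Tuple n d) → ¬ T (meets τ t) → Disjoint τ t
    ¬meets⇒Disjoint τ t ¬meet k l τk≡tl = ¬meet (any⁺ _ (Any.map (λ { refl → at-k }) (∈-allFin k)))
      where
      at-k : T (any (λ l′ → lookup τ k == lookup t l′) (allFin d))
      at-k = any⁺ _ (Any.map (λ { refl → subst (λ u → T (lookup τ k == u)) τk≡tl (==-refl (lookup τ k)) }) (∈-allFin l))

    greedy-disjoint : (σ : List (Tuple n d)) → AllPairs Disjoint (greedy σ)
    greedy-disjoint [] = []
    greedy-disjoint (τ ∷ σ) with admissible τ (greedy σ) in eq
    ... | true = All.map (λ {t} → ¬meets⇒Disjoint τ t) (¬Any⇒All¬ _ (no-clash ∘ any⁺ (meets τ))) ∷ greedy-disjoint σ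
      where
      no-clash : ¬ T (clashes τ (greedy σ))
      no-clash c = subst T (to T-not-≡ (proj₁ (to T-∧ (from T-≡ eq)))) c
    ... | false = greedy-disjoint σ

    meets-count : (t : Tuple n d) → n * ∑[ τ ∈ allTuples n d ] 𝟙 (meets τ t) ≤ d * (d * n ^ d)
    meets-count t = begin
      n * ∑[ τ ∈ Ts ] 𝟙 (meets τ t)
        ≤⟨ *-monoʳ-≤ n (∑-mono-≤ Ts λ τ → ≤-trans (𝟙-any-≤ _ (allFin d)) (∑-mono-≤ (allFin d) λ k → 𝟙-any-≤ _ (allFin d))) ⟩
      n * ∑[ τ ∈ Ts ] ∑[ k ∈ allFin d ] ∑[ l ∈ allFin d ] 𝟙 (lookup τ k == lookup t l)
        ≡⟨ cong (n *_) (trans (∑-comm Ts (allFin d) _) (∑-cong (allFin d) λ k → ∑-comm Ts (allFin d) _)) ⟩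
      n * ∑[ k ∈ allFin d ] ∑[ l ∈ allFin d ] ∑[ τ ∈ Ts ] 𝟙 (lookup τ k == lookup t l)
        ≡⟨ sym (trans (∑-cong (allFin d) λ k → ∑-distribˡ-* (allFin d) n _) (∑-distribˡ-* (allFin d) n _)) ⟩
      ∑[ k ∈ allFin d ] ∑[ l ∈ allFin d ] (n * ∑[ τ ∈ Ts ] 𝟙 (lookup τ k == lookup t l))
        ≡⟨ ∑-cong (allFin d) (λ k → ∑-cong (allFin d) λ l → count-lookup-== n d (lookup t l) k) ⟩
      ∑[ k ∈ allFin d ] ∑[ l ∈ allFin d ] (n ^ d)
        ≡⟨ trans (∑-cong (allFin d) λ _ → ∑-allFin-const d (n ^ d)) (∑-allFin-const d _) ⟩
      d * (d * n ^ d) ∎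
      where
      open ≤-Reasoning
      Ts : List (Tuple n d)
      Ts = allTuples n d

    clash-count : (F : List (Tuple n d)) → n * ∑[ τ ∈ allTuples n d ] 𝟙 (clashes τ F) ≤ length F * (d * (d * n ^ d))
    clash-count F = begin
      n * ∑[ τ ∈ Ts ] 𝟙 (clashes τ F)           ≤⟨ *-monoʳ-≤ n (∑-mono-≤ Ts λ τ → 𝟙-any-≤ (meets τ) F) ⟩
      n * ∑[ τ ∈ Ts ] ∑[ t ∈ F ] 𝟙 (meets τ t)  ≡⟨ cong (n *_) (∑-comm Ts F _) ⟩
      n * ∑[ t ∈ F ] ∑[ τ ∈ Ts ] 𝟙 (meets τ t)  ≡⟨ sym (∑-distribˡ-* F n _) ⟩
      ∑[ t ∈ F ] (n * ∑[ τ ∈ Ts ] 𝟙 (meets τ t))  ≤⟨ ∑-mono-≤ F meets-count ⟩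
      ∑[ t ∈ F ] (d * (d * n ^ d))                ≡⟨ ∑-const F _ ⟩
      length F * (d * (d * n ^ d))               ∎
      where
      open ≤-Reasoning
      Ts : List (Tuple n d)
      Ts = allTuples n d

    hit : Subset n → Tuple n d → List (Tuple n d) → Bool
    hit S τ F = f S τ ∧ admissible τ F

    f≤hit+clash : (S : Subset n) (τ : Tuple n d) (F : List (Tuple n d)) → ∣ S ∣ ≡ m →
                  𝟙 (f S τ) ≤ 𝟙 (hit S τ F) + 𝟙 (clashes τ F)
    f≤hit+clash S τ F size with f S τ in fSτ
    ... | false = z≤n
    ... | true with good τ | witness⇒good S τ size fSτ | clashes τ F
    ...   | true | _ | true = ≤-refl
    ...   | true | _ | false = ≤-refl

    hit-count : (F : List (Tuple n d)) (S : Subset n) → ∣ S ∣ ≡ m →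
                n * card (f S) ≤ n * ∑[ τ ∈ allTuples n d ] 𝟙 (hit S τ F) + length F * (d * (d * n ^ d))
    hit-count F S size = begin
      n * card (f S)
        ≡⟨ cong (n *_) (length-filter≡∑𝟙 Ts (f S)) ⟩
      n * ∑[ τ ∈ Ts ] 𝟙 (f S τ)
        ≤⟨ *-monoʳ-≤ n (∑-mono-≤ Ts λ τ → f≤hit+clash S τ F size) ⟩
      n * ∑[ τ ∈ Ts ] (𝟙 (hit S τ F) + 𝟙 (clashes τ F))
        ≡⟨ trans (cong (n *_) (∑-distrib-+ Ts _ _)) (*-distribˡ-+ n _ _) ⟩
      n * ∑[ τ ∈ Ts ] 𝟙 (hit S τ F) + n * ∑[ τ ∈ Ts ] 𝟙 (clashes τ F)
        ≤⟨ +-monoʳ-≤ _ (clash-count F) ⟩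
      n * ∑[ τ ∈ Ts ] 𝟙 (hit S τ F) + length F * (d * (d * n ^ d)) ∎
      where
      open ≤-Reasoning
      Ts : List (Tuple n d)
      Ts = allTuples n d

    hits : Subset n → List (Tuple n d) → ℕ
    hits S F = ∑[ t ∈ F ] 𝟙 (f S t)

    hits-greedy-∷ : (S : Subset n) (τ : Tuple n d) (σ : List (Tuple n d)) →
                    hits S (greedy (τ ∷ σ)) ≡ 𝟙 (hit S τ (greedy σ)) + hits S (greedy σ)
    hits-greedy-∷ S τ σ with admissible τ (greedy σ)
    ... | true = cong (λ b → 𝟙 b + hits S (greedy σ)) (sym (∧-identityʳ (f S τ)))
    ... | false = cong (λ b → 𝟙 b + hits S (greedy σ)) (sym (∧-zeroʳ (f S τ)))

    freshHits : Subset n → List (Tuple n d) → ℕ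
    freshHits S σ = ∑[ τ ∈ allTuples n d ] 𝟙 (hit S τ (greedy σ))

    -- Each of the at most g n / P accepted tuples blocks at most d² n^(d - 1) candidates.
    freshHits-≥ : 0 < n → (A D P g R : ℕ) → A * P ≡ R + D * (d * (d * g)) →
                  (S : Subset n) (σ : List (Tuple n d)) → ∣ S ∣ ≡ m → A * n ^ d ≤ D * card (f S) →
                  P * length (greedy σ) ≤ g * n → R * n ^ d ≤ P * D * freshHits S σ
    freshHits-≥ 0<n A D P g R AP≡ S σ size dense few = *-cancelˡ-≤ n {{>-nonZero 0<n}} (+-cancelʳ-≤ _ _ _ (begin
      n * (R * N) + n * (D * (d * (d * g))) * N ≡⟨ expand₁ n R N (D * (d * (d * g))) ⟩
      n * (R + D * (d * (d * g))) * N           ≡⟨ cong (λ e → n * e * N) AP≡ ⟨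
      n * (A * P) * N                            ≡⟨ expand₂ n A P N ⟩
      P * (A * N) * n                            ≤⟨ *-monoˡ-≤ n (*-monoʳ-≤ P dense) ⟩
      P * (D * card (f S)) * n                  ≡⟨ expand₃ P D (card (f S)) n ⟩
      P * D * (n * card (f S))                  ≤⟨ *-monoʳ-≤ (P * D) (hit-count (greedy σ) S size) ⟩
      P * D * (n * H + length F * (d * (d * N))) ≡⟨ expand₄ P D n H (length F) d N ⟩
      n * (P * D * H) + D * (d * (d * (P * length F))) * N ≤⟨ +-monoʳ-≤ _ (*-monoˡ-≤ N (*-monoʳ-≤ D (*-monoʳ-≤ d (*-monoʳ-≤ d few)))) ⟩
      n * (P * D * H) + D * (d * (d * (g * n))) * N ≡⟨ cong (n * (P * D * H) +_) (expand₅ D d g n N) ⟩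
      n * (P * D * H) + n * (D * (d * (d * g))) * N ∎))
      where
      open ≤-Reasoning
      N H : ℕ
      N = n ^ d
      H = freshHits S σ
      F : List (Tuple n d)
      F = greedy σ
      expand₁ : ∀ n R N G → n * (R * N) + n * G * N ≡ n * (R + G) * N
      expand₁ = solve-∀
      expand₂ : ∀ n A P N → n * (A * P) * N ≡ P * (A * N) * n
      expand₂ = solve-∀
      expand₃ : ∀ P D c n → P * (D * c) * n ≡ P * D * (n * c)
      expand₃ = solve-∀
      expand₄ : ∀ P D n H l d N → P * D * (n * H + l * (d * (d * N))) ≡ n * (P * D * H) + D * (d * (d * (P * l))) * N
      expand₄ = solve-∀
      expand₅ : ∀ D d g n N → D * (d * (d * (g * n))) * N ≡ n * (D * (d * (d * g))) * N
      expand₅ = solve-∀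

    -- The pessimistic estimator for the method of conditional expectations.
    module Potential (M : ℕ) where

      weight : Subset n → List (Tuple n d) → ℕ
      weight S [] = 1
      weight S (τ ∷ σ) = weight S σ * (M ∸ 𝟙 (hit S τ (greedy σ)))

      weight-closed : (S : Subset n) (σ : List (Tuple n d)) →
                      weight S σ * M ^ hits S (greedy σ) ≡ (M ∸ 1) ^ hits S (greedy σ) * M ^ length σ
      weight-closed S [] = refl
      weight-closed S (τ ∷ σ) rewrite hits-greedy-∷ S τ σ with hit S τ (greedy σ)
      ... | true = begin
        weight S σ * (M ∸ 1) * (M * M ^ h)              ≡⟨ rearrange (weight S σ) (M ∸ 1) M (M ^ h) ⟩
        weight S σ * M ^ h * ((M ∸ 1) * M)              ≡⟨ cong (_* ((M ∸ 1) * M)) (weight-closed S σ) ⟩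
        (M ∸ 1) ^ h * M ^ length σ * ((M ∸ 1) * M)      ≡⟨ regroup ((M ∸ 1) ^ h) (M ^ length σ) (M ∸ 1) M ⟩
        (M ∸ 1) * (M ∸ 1) ^ h * (M * M ^ length σ)      ∎
        where
        open ≡-Reasoning
        h : ℕ
        h = hits S (greedy σ)
        rearrange : ∀ w c M X → w * c * (M * X) ≡ w * X * (c * M)
        rearrange = solve-∀
        regroup : ∀ Y Z c M → Y * Z * (c * M) ≡ c * Y * (M * Z)
        regroup = solve-∀
      ... | false = begin
        weight S σ * M * M ^ h                  ≡⟨ *-assoc (weight S σ) M (M ^ h) ⟩
        weight S σ * (M * M ^ h)                ≡⟨ cong (weight S σ *_) (*-comm M (M ^ h)) ⟩
        weight S σ * (M ^ h * M)                ≡⟨ *-assoc (weight S σ) (M ^ h) M ⟨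
        weight S σ * M ^ h * M                  ≡⟨ cong (_* M) (weight-closed S σ) ⟩
        (M ∸ 1) ^ h * M ^ length σ * M          ≡⟨ *-assoc ((M ∸ 1) ^ h) (M ^ length σ) M ⟩
        (M ∸ 1) ^ h * (M ^ length σ * M)        ≡⟨ cong ((M ∸ 1) ^ h *_) (*-comm (M ^ length σ) M) ⟩
        (M ∸ 1) ^ h * (M * M ^ length σ)        ∎
        where
        open ≡-Reasoning
        h : ℕ
        h = hits S (greedy σ)

      weight-lower : (S : Subset n) (σ : List (Tuple n d)) (L : ℕ) → hits S (greedy σ) ≤ L →
                     (M ∸ 1) ^ L * M ^ length σ ≤ weight S σ * M ^ L
      weight-lower S σ L h≤L = begin
        (M ∸ 1) ^ L * M ^ length σ                   ≡⟨ cong (λ e → (M ∸ 1) ^ e * M ^ length σ) (sym (m∸n+n≡m h≤L)) ⟩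
        (M ∸ 1) ^ (L ∸ h + h) * M ^ length σ         ≡⟨ cong (_* M ^ length σ) (^-distribˡ-+-* (M ∸ 1) (L ∸ h) h) ⟩
        (M ∸ 1) ^ (L ∸ h) * (M ∸ 1) ^ h * M ^ length σ ≡⟨ *-assoc ((M ∸ 1) ^ (L ∸ h)) _ _ ⟩
        (M ∸ 1) ^ (L ∸ h) * ((M ∸ 1) ^ h * M ^ length σ) ≡⟨ cong ((M ∸ 1) ^ (L ∸ h) *_) (sym (weight-closed S σ)) ⟩
        (M ∸ 1) ^ (L ∸ h) * (weight S σ * M ^ h)     ≤⟨ *-monoˡ-≤ _ (^-monoˡ-≤ (L ∸ h) (m∸n≤m M 1)) ⟩
        M ^ (L ∸ h) * (weight S σ * M ^ h)           ≡⟨ *-CS.x∙yz≈y∙xz (M ^ (L ∸ h)) (weight S σ) (M ^ h) ⟩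
        weight S σ * (M ^ (L ∸ h) * M ^ h)           ≡⟨ cong (weight S σ *_) (sym (^-distribˡ-+-* M (L ∸ h) h)) ⟩
        weight S σ * M ^ (L ∸ h + h)                 ≡⟨ cong (λ e → weight S σ * M ^ e) (m∸n+n≡m h≤L) ⟩
        weight S σ * M ^ L                           ∎
        where
        open ≤-Reasoning
        h : ℕ
        h = hits S (greedy σ)

      ω : Subset n → List (Tuple n d) → ℕ
      ω S σ = 𝟙 (hasSize S) * weight S σ

      Φ : List (Tuple n d) → ℕ
      Φ σ = ∑[ S ∈ allSubsets n ] ω S σ

      Φ-[]-≤ : Φ [] ≤ n ^ m
      Φ-[]-≤ = ≤-trans (≤-reflexive (∑-cong (allSubsets n) λ S → *-identityʳ (𝟙 (hasSize S)))) (subsets-of-size-≤ n m)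

      weight-≤-Φ : (S : Subset n) (σ : List (Tuple n d)) → ∣ S ∣ ≡ m → weight S σ ≤ Φ σ
      weight-≤-Φ S σ size = ≤-trans (≤-reflexive weight≡) (∈⇒≤∑ (λ S → ω S σ) (∈-allSubsets n S))
        where
        weight≡ : weight S σ ≡ ω S σ
        weight≡ = sym (trans (cong (λ b → 𝟙 b * weight S σ) (to T-≡ (≡⇒≡ᵇ ∣ S ∣ m size))) (*-identityˡ _))

      -- Summing the next potential over all candidates: each S loses exactly its fresh hits.
      ∑-Φ-∷ : 1 ≤ M → (σ : List (Tuple n d)) →
              ∑[ τ ∈ allTuples n d ] Φ (τ ∷ σ) + ∑[ S ∈ allSubsets n ] (ω S σ * freshHits S σ)
                ≡ M * n ^ d * Φ σ
      ∑-Φ-∷ 1≤M σ = begin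
        ∑[ τ ∈ Ts ] Φ (τ ∷ σ) + ∑[ S ∈ Ss ] (ω S σ * freshHits S σ)
          ≡⟨ cong (_+ ∑[ S ∈ Ss ] (ω S σ * freshHits S σ)) (trans (∑-cong Ts λ τ → ∑-cong Ss λ S → sym (*-assoc (𝟙 (hasSize S)) _ _)) (∑-comm Ts Ss _)) ⟩
        ∑[ S ∈ Ss ] ∑[ τ ∈ Ts ] (ω S σ * miss S τ) + ∑[ S ∈ Ss ] (ω S σ * freshHits S σ)
          ≡⟨ sym (∑-distrib-+ Ss _ _) ⟩
        ∑[ S ∈ Ss ] (∑[ τ ∈ Ts ] (ω S σ * miss S τ) + ω S σ * freshHits S σ)
          ≡⟨ ∑-cong Ss (λ S → trans (cong (_+ ω S σ * freshHits S σ) (∑-distribˡ-* Ts (ω S σ) (miss S))) (sym (*-distribˡ-+ (ω S σ) _ _))) ⟩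
        ∑[ S ∈ Ss ] (ω S σ * (∑[ τ ∈ Ts ] miss S τ + freshHits S σ))
          ≡⟨ ∑-cong Ss (λ S → cong (ω S σ *_) (trans (sym (∑-distrib-+ Ts _ _)) (∑-cong Ts λ τ → m∸n+n≡m (≤-trans (𝟙≤1 (hit S τ (greedy σ))) 1≤M)))) ⟩
        ∑[ S ∈ Ss ] (ω S σ * ∑[ _ ∈ Ts ] M)
          ≡⟨ ∑-cong Ss (λ S → cong (ω S σ *_) (trans (∑-const Ts M) (trans (cong (_* M) (length-allTuples n d)) (*-comm (n ^ d) M)))) ⟩
        ∑[ S ∈ Ss ] (ω S σ * (M * n ^ d))
          ≡⟨ trans (∑-cong Ss λ S → *-comm (ω S σ) _) (∑-distribˡ-* Ss (M * n ^ d) (λ S → ω S σ)) ⟩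
        M * n ^ d * Φ σ ∎
        where
        open ≡-Reasoning
        Ts : List (Tuple n d)
        Ts = allTuples n d
        Ss : List (Subset n)
        Ss = allSubsets n
        miss : Subset n → Tuple n d → ℕ
        miss S τ = M ∸ 𝟙 (hit S τ (greedy σ))

      loss-≥ : (q r : ℕ) (σ : List (Tuple n d)) → (∀ S → ∣ S ∣ ≡ m → r * n ^ d ≤ q * freshHits S σ) →
               r * n ^ d * Φ σ ≤ q * ∑[ S ∈ allSubsets n ] (ω S σ * freshHits S σ)
      loss-≥ q r σ dense = begin
        r * n ^ d * Φ σ                                   ≡⟨ sym (∑-distribˡ-* Ss (r * n ^ d) _) ⟩
        ∑[ S ∈ Ss ] (r * n ^ d * ω S σ)  ≤⟨ ∑-mono-≤ Ss per-subset ⟩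
        ∑[ S ∈ Ss ] (q * (ω S σ * freshHits S σ))  ≡⟨ ∑-distribˡ-* Ss q _ ⟩
        q * ∑[ S ∈ Ss ] (ω S σ * freshHits S σ) ∎
        where
        open ≤-Reasoning
        Ss : List (Subset n)
        Ss = allSubsets n
        per-subset : ∀ S → r * n ^ d * ω S σ ≤ q * (ω S σ * freshHits S σ)
        per-subset S with hasSize S in size
        ... | false = ≤-trans (≤-reflexive (*-zeroʳ (r * n ^ d))) z≤n
        ... | true = begin
          r * n ^ d * (1 * weight S σ)          ≤⟨ *-monoˡ-≤ (1 * weight S σ) (dense S (≡ᵇ⇒≡ ∣ S ∣ m (from T-≡ size))) ⟩
          q * freshHits S σ * (1 * weight S σ)  ≡⟨ *-CS.xy∙z≈x∙zy q (freshHits S σ) _ ⟩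
          q * (1 * weight S σ * freshHits S σ)  ∎

      -- Some candidate does at least as well as the average one.
      ∃-step : 1 ≤ M → 0 < n → (q r : ℕ) (σ : List (Tuple n d)) →
               (∀ S → ∣ S ∣ ≡ m → r * n ^ d ≤ q * freshHits S σ) →
               ∃[ τ ] (q * Φ (τ ∷ σ) ≤ (M * q ∸ r) * Φ σ)
      ∃-step 1≤M 0<n q r σ dense = τ , (begin
        q * Φ (τ ∷ σ)          ≤⟨ m+n≤o⇒m≤o∸n (q * Φ (τ ∷ σ)) (*-cancelʳ-≤ _ _ N {{>-nonZero N>0}} scaled) ⟩
        M * q * Φ σ ∸ r * Φ σ  ≡⟨ *-distribʳ-∸ (Φ σ) (M * q) r ⟨
        (M * q ∸ r) * Φ σ      ∎)
        where
        open ≤-Reasoning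
        Ts : List (Tuple n d)
        Ts = allTuples n d
        N : ℕ
        N = n ^ d
        N>0 : 0 < N
        N>0 = m^n>0 n {{>-nonZero 0<n}} d
        total : q * ∑[ τ ∈ Ts ] Φ (τ ∷ σ) + r * N * Φ σ ≤ M * q * N * Φ σ
        total = begin
          q * ∑[ τ ∈ Ts ] Φ (τ ∷ σ) + r * N * Φ σ    ≤⟨ +-monoʳ-≤ _ (loss-≥ q r σ dense) ⟩
          q * ∑[ τ ∈ Ts ] Φ (τ ∷ σ) + q * _           ≡⟨ *-distribˡ-+ q _ _ ⟨
          q * (∑[ τ ∈ Ts ] Φ (τ ∷ σ) + _)             ≡⟨ cong (q *_) (∑-Φ-∷ 1≤M σ) ⟩
          q * (M * N * Φ σ)                           ≡⟨ rearrange q M N (Φ σ) ⟩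
          M * q * N * Φ σ                             ∎
          where
          rearrange : ∀ q M N F → q * (M * N * F) ≡ M * q * N * F
          rearrange = solve-∀
        below-average : ∃[ τ ] (Φ (τ ∷ σ) * N ≤ ∑[ τ ∈ Ts ] Φ (τ ∷ σ))
        below-average = subst (λ k → ∃[ τ ] (Φ (τ ∷ σ) * k ≤ ∑[ τ ∈ Ts ] Φ (τ ∷ σ))) (length-allTuples n d)
                              (∃-below-average Ts (λ τ → Φ (τ ∷ σ)) (subst (0 <_) (sym (length-allTuples n d)) N>0))
        τ : Tuple n d
        τ = proj₁ below-average
        scaled : (q * Φ (τ ∷ σ) + r * Φ σ) * N ≤ M * q * Φ σ * N
        scaled = begin
          (q * Φ (τ ∷ σ) + r * Φ σ) * N        ≡⟨ expand q (Φ (τ ∷ σ)) r (Φ σ) N ⟩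
          q * (Φ (τ ∷ σ) * N) + r * N * Φ σ    ≤⟨ +-monoˡ-≤ _ (*-monoʳ-≤ q (proj₂ below-average)) ⟩
          q * ∑[ τ ∈ Ts ] Φ (τ ∷ σ) + r * N * Φ σ ≤⟨ total ⟩
          M * q * N * Φ σ                      ≡⟨ *-CS.xy∙z≈xz∙y (M * q) N (Φ σ) ⟩
          M * q * Φ σ * N                      ∎
          where
          expand : ∀ q G r F N → (q * G + r * F) * N ≡ q * (G * N) + r * N * F
          expand = solve-∀

      iterate : (q e K : ℕ) → (∀ σ → length σ < K → ∃[ τ ] (q * Φ (τ ∷ σ) ≤ e * Φ σ)) →
                ∃[ σ ] (length σ ≡ K × q ^ K * Φ σ ≤ e ^ K * Φ [])
      iterate q e K step = go K ≤-refl
        where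
        go : ∀ t → t ≤ K → ∃[ σ ] (length σ ≡ t × q ^ t * Φ σ ≤ e ^ t * Φ [])
        go zero _ = [] , refl , ≤-refl
        go (suc t) t<K with go t (<⇒≤ t<K)
        ... | σ , refl , bound with step σ t<K
        ...   | τ , improved = τ ∷ σ , refl , (begin
          q * q ^ t * Φ (τ ∷ σ)    ≡⟨ *-CS.xy∙z≈y∙xz q (q ^ t) _ ⟩
          q ^ t * (q * Φ (τ ∷ σ))  ≤⟨ *-monoʳ-≤ (q ^ t) improved ⟩
          q ^ t * (e * Φ σ)        ≡⟨ *-CS.x∙yz≈y∙xz (q ^ t) e (Φ σ) ⟩
          e * (q ^ t * Φ σ)        ≤⟨ *-monoʳ-≤ e bound ⟩
          e * (e ^ t * Φ [])       ≡⟨ *-assoc e (e ^ t) (Φ []) ⟨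
          e * e ^ t * Φ []         ∎)
          where open ≤-Reasoning

module Asymptotics where

  open import Data.Nat
  open import Data.Nat.Properties
  import Algebra.Properties.CommutativeSemigroup *-commutativeSemigroup as *-CS
  open import Data.Nat.Tactic.RingSolver using (solve-∀)
  open import Data.Sum using (inj₁; inj₂)
  open import Relation.Binary.PropositionalEquality

  ^-distribʳ-* : ∀ a b k → (a * b) ^ k ≡ a ^ k * b ^ k
  ^-distribʳ-* a b zero = refl
  ^-distribʳ-* a b (suc k) = trans (cong (a * b *_) (^-distribʳ-* a b k)) (*-CS.interchange a b (a ^ k) (b ^ k))

  1≤^ : ∀ a k → 1 ≤ a → 1 ≤ a ^ k
  1≤^ a k 1≤a = m^n>0 a {{>-nonZero 1≤a}} k

  n<2^n : ∀ n → n < 2 ^ n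
  n<2^n zero = s≤s z≤n
  n<2^n (suc n) = begin-strict
    suc n          <⟨ s≤s (n<2^n n) ⟩
    suc (2 ^ n)    ≡⟨ +-comm 1 (2 ^ n) ⟩
    2 ^ n + 1      ≤⟨ +-monoʳ-≤ (2 ^ n) (1≤^ 2 n (s≤s z≤n)) ⟩
    2 ^ n + 2 ^ n  ≡⟨ cong (2 ^ n +_) (sym (+-identityʳ (2 ^ n))) ⟩
    2 ^ suc n      ∎
    where open ≤-Reasoning

  binomial-≥ : ∀ x k → x ^ suc k + suc k * x ^ k ≤ (x + 1) ^ suc k
  binomial-≥ x zero = ≤-reflexive (base x)
    where
    base : ∀ x → x * 1 + 1 * 1 ≡ (x + 1) * 1
    base = solve-∀
  binomial-≥ x (suc k) = +-cancelʳ-≤ (suc k * x ^ k) _ _ (begin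
    x * (x * x ^ k) + suc (suc k) * (x * x ^ k) + suc k * x ^ k ≡⟨ expand x (x ^ k) k ⟩
    (x + 1) * (x * x ^ k + suc k * x ^ k)                       ≤⟨ *-monoʳ-≤ (x + 1) (binomial-≥ x k) ⟩
    (x + 1) * (x + 1) ^ suc k                                   ≤⟨ m≤m+n _ _ ⟩
    (x + 1) * (x + 1) ^ suc k + suc k * x ^ k                   ∎)
    where
    open ≤-Reasoning
    expand : ∀ x p k → x * (x * p) + (2 + k) * (x * p) + (1 + k) * p ≡ (x + 1) * (x * p + (1 + k) * p)
    expand = solve-∀

  -- A gap x < y, raised to a power of order Z x, becomes a factor Z.
  amplify-gap : ∀ x y Z → x < y → Z * x ^ suc (Z * x) ≤ y ^ suc (Z * x)
  amplify-gap x y Z x<y = begin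
    Z * (x * x ^ j)             ≡⟨ *-assoc Z x (x ^ j) ⟨
    j * x ^ j                   ≤⟨ *-monoˡ-≤ (x ^ j) (n≤1+n j) ⟩
    suc j * x ^ j               ≤⟨ m≤n+m _ (x ^ suc j) ⟩
    x ^ suc j + suc j * x ^ j   ≤⟨ binomial-≥ x j ⟩
    (x + 1) ^ suc j             ≤⟨ ^-monoˡ-≤ (suc j) (subst (_≤ y) (+-comm 1 x) x<y) ⟩
    y ^ suc j                   ∎
    where
    open ≤-Reasoning
    j : ℕ
    j = Z * x

  polynomial<exponential : ∀ m X Y C s → 2 ^ suc m * X ≤ Y → 1 ≤ X → C ≤ s → C * (suc s ^ m * X ^ s) < Y ^ s
  polynomial<exponential m X Y C s 2^[m+1]X≤Y 1≤X C≤s = begin-strict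
    C * Q                           <⟨ *-monoˡ-< Q {{>-nonZero Q>0}} (≤-<-trans C≤s (n<2^n s)) ⟩
    2 ^ s * Q                       ≤⟨ *-monoʳ-≤ (2 ^ s) (*-monoˡ-≤ (X ^ s) (^-monoˡ-≤ m (n<2^n s))) ⟩
    2 ^ s * ((2 ^ s) ^ m * X ^ s)   ≡⟨ cong (λ e → 2 ^ s * (e * X ^ s)) 2^s^m≡2^m^s ⟩
    2 ^ s * ((2 ^ m) ^ s * X ^ s)   ≡⟨ *-assoc (2 ^ s) _ _ ⟨
    2 ^ s * (2 ^ m) ^ s * X ^ s     ≡⟨ cong (_* X ^ s) (^-distribʳ-* 2 (2 ^ m) s) ⟨
    (2 ^ suc m) ^ s * X ^ s         ≡⟨ ^-distribʳ-* (2 ^ suc m) X s ⟨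
    (2 ^ suc m * X) ^ s             ≤⟨ ^-monoˡ-≤ s 2^[m+1]X≤Y ⟩
    Y ^ s                           ∎
    where
    open ≤-Reasoning
    Q : ℕ
    Q = suc s ^ m * X ^ s
    Q>0 : 0 < Q
    Q>0 = *-mono-≤ (1≤^ (suc s) m (s≤s z≤n)) (1≤^ X s 1≤X)
    2^s^m≡2^m^s : (2 ^ s) ^ m ≡ (2 ^ m) ^ s
    2^s^m≡2^m^s = trans (^-*-assoc 2 s m) (trans (cong (2 ^_) (*-comm s m)) (sym (^-*-assoc 2 m s)))

  bernoulli : ∀ E R g → E ^ g * (E + g * R) ≤ E * (E + R) ^ g
  bernoulli E R zero = ≤-reflexive (base E R)
    where
    base : ∀ E R → 1 * (E + 0 * R) ≡ E * 1
    base = solve-∀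
  bernoulli E R (suc g) = begin
    E * E ^ g * (E + suc g * R)                     ≤⟨ m≤m+n _ (E ^ g * g * R * R) ⟩
    E * E ^ g * (E + suc g * R) + E ^ g * g * R * R ≡⟨ factor E R g (E ^ g) ⟩
    (E + R) * (E ^ g * (E + g * R))                 ≤⟨ *-monoʳ-≤ (E + R) (bernoulli E R g) ⟩
    (E + R) * (E * (E + R) ^ g)                     ≡⟨ *-CS.x∙yz≈y∙xz (E + R) E ((E + R) ^ g) ⟩
    E * ((E + R) * (E + R) ^ g)                     ∎
    where
    open ≤-Reasoning
    factor : ∀ E R g p → E * p * (E + (1 + g) * R) + p * g * R * R ≡ (E + R) * (p * (E + g * R))
    factor = solve-∀

  ∸-*-+-≤ : ∀ E R → (E ∸ R) * (E + R) ≤ E * E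
  ∸-*-+-≤ E R with ≤-total R E
  ... | inj₂ E≤R rewrite m≤n⇒m∸n≡0 E≤R = z≤n
  ... | inj₁ R≤E = begin
    (E ∸ R) * (E + R)        ≡⟨ cong (λ e → (E ∸ R) * (e + R)) (sym (m∸n+n≡m R≤E)) ⟩
    u * (u + R + R)          ≤⟨ m≤m+n _ (R * R) ⟩
    u * (u + R + R) + R * R  ≡⟨ square u R ⟩
    (u + R) * (u + R)        ≡⟨ cong (λ e → e * e) (m∸n+n≡m R≤E) ⟩
    E * E                    ∎
    where
    open ≤-Reasoning
    u : ℕ
    u = E ∸ R
    square : ∀ u R → u * (u + R + R) + R * R ≡ (u + R) * (u + R)
    square = solve-∀

  ∸-^-≤ : ∀ E R g → 1 ≤ E → (E ∸ R) ^ g * (E + g * R) ≤ E * E ^ g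
  ∸-^-≤ E R g 1≤E = *-cancelˡ-≤ (E ^ g) {{>-nonZero (1≤^ E g 1≤E)}} (begin
    E ^ g * ((E ∸ R) ^ g * (E + g * R)) ≡⟨ *-CS.x∙yz≈y∙xz (E ^ g) ((E ∸ R) ^ g) _ ⟩
    (E ∸ R) ^ g * (E ^ g * (E + g * R)) ≤⟨ *-monoʳ-≤ ((E ∸ R) ^ g) (bernoulli E R g) ⟩
    (E ∸ R) ^ g * (E * (E + R) ^ g)     ≡⟨ *-CS.x∙yz≈y∙xz ((E ∸ R) ^ g) E ((E + R) ^ g) ⟩
    E * ((E ∸ R) ^ g * (E + R) ^ g)     ≡⟨ cong (E *_) (^-distribʳ-* (E ∸ R) (E + R) g) ⟨
    E * ((E ∸ R) * (E + R)) ^ g         ≤⟨ *-monoʳ-≤ E (^-monoˡ-≤ g (∸-*-+-≤ E R)) ⟩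
    E * (E * E) ^ g                     ≡⟨ cong (E *_) (^-distribʳ-* E E g) ⟩
    E * (E ^ g * E ^ g)                 ≡⟨ *-CS.x∙yz≈y∙xz E (E ^ g) (E ^ g) ⟩
    E ^ g * (E * E ^ g)                 ∎)
    where open ≤-Reasoning

  bernoulli-∸1 : ∀ M h → M ^ suc h ≤ (M ∸ 1) ^ h * M + h * M ^ h
  bernoulli-∸1 zero h = z≤n
  bernoulli-∸1 (suc ν) zero = ≤-reflexive (base ν)
    where
    base : ∀ ν → (1 + ν) * 1 ≡ 1 * (1 + ν) + 0
    base = solve-∀
  bernoulli-∸1 M@(suc ν) (suc h) = begin
    M * (M * M ^ h)                                      ≡⟨ split ν (M ^ h) ⟩
    ν * (M * M ^ h) + M * M ^ h                          ≤⟨ +-monoˡ-≤ (M * M ^ h) (*-monoʳ-≤ ν (bernoulli-∸1 M h)) ⟩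
    ν * (ν ^ h * M + h * M ^ h) + M * M ^ h              ≤⟨ m≤m+n _ (h * M ^ h) ⟩
    ν * (ν ^ h * M + h * M ^ h) + M * M ^ h + h * M ^ h  ≡⟨ regroup ν (ν ^ h) h (M ^ h) ⟩
    ν * ν ^ h * M + suc h * (M * M ^ h)                  ∎
    where
    open ≤-Reasoning
    split : ∀ ν p → (1 + ν) * ((1 + ν) * p) ≡ ν * ((1 + ν) * p) + (1 + ν) * p
    split = solve-∀
    regroup : ∀ ν q h p → ν * (q * (1 + ν) + h * p) + (1 + ν) * p + h * p ≡ ν * q * (1 + ν) + (1 + h) * ((1 + ν) * p)
    regroup = solve-∀

  ∸-^-ratio-< : ∀ E R g M h μ → M ≡ h + μ → 1 ≤ E → E * M < (E + g * R) * μ → (E ∸ R) ^ g * M ^ h < E ^ g * (M ∸ 1) ^ h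
  ∸-^-ratio-< E R g M h μ M≡h+μ 1≤E EM<E′μ = *-cancelʳ-< (E′ * M) _ _ (begin-strict
    (E ∸ R) ^ g * M ^ h * (E′ * M)  ≡⟨ *-CS.interchange ((E ∸ R) ^ g) (M ^ h) E′ M ⟩
    (E ∸ R) ^ g * E′ * (M ^ h * M)  ≤⟨ *-monoˡ-≤ (M ^ h * M) (∸-^-≤ E R g 1≤E) ⟩
    E * E ^ g * (M ^ h * M)         ≡⟨ rearrange E (E ^ g) (M ^ h) M ⟩
    E ^ g * M ^ h * (E * M)         <⟨ *-monoʳ-< (E ^ g * M ^ h) {{>-nonZero E^gM^h>0}} EM<E′μ ⟩
    E ^ g * M ^ h * (E′ * μ)        ≡⟨ *-CS.interchange (E ^ g) (M ^ h) E′ μ ⟩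
    E ^ g * E′ * (M ^ h * μ)        ≤⟨ *-monoʳ-≤ (E ^ g * E′) M^hμ≤[M∸1]^hM ⟩
    E ^ g * E′ * ((M ∸ 1) ^ h * M)  ≡⟨ *-CS.interchange (E ^ g) E′ ((M ∸ 1) ^ h) M ⟩
    E ^ g * (M ∸ 1) ^ h * (E′ * M)  ∎)
    where
    open ≤-Reasoning
    E′ : ℕ
    E′ = E + g * R
    rearrange : ∀ a b c d → a * b * (c * d) ≡ b * c * (a * d)
    rearrange = solve-∀
    1≤M : 1 ≤ M
    1≤M = subst (1 ≤_) (sym M≡h+μ) (≤-trans 1≤μ (m≤n+m μ h))
      where
      1≤μ : 1 ≤ μ
      1≤μ = n≢0⇒n>0 λ { refl → n≮0 (subst (E * M <_) (*-zeroʳ E′) EM<E′μ) }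
    E^gM^h>0 : 0 < E ^ g * M ^ h
    E^gM^h>0 = *-mono-≤ (1≤^ E g 1≤E) (1≤^ M h 1≤M)
    M^hμ≤[M∸1]^hM : M ^ h * μ ≤ (M ∸ 1) ^ h * M
    M^hμ≤[M∸1]^hM = +-cancelʳ-≤ (h * M ^ h) _ _ (begin
      M ^ h * μ + h * M ^ h  ≡⟨ trans (cong (M ^ h * μ +_) (*-comm h (M ^ h))) (sym (*-distribˡ-+ (M ^ h) μ h)) ⟩
      M ^ h * (μ + h)        ≡⟨ cong (M ^ h *_) (trans (+-comm μ h) (sym M≡h+μ)) ⟩
      M ^ h * M              ≡⟨ *-comm (M ^ h) M ⟩
      M ^ suc h              ≤⟨ bernoulli-∸1 M h ⟩
      (M ∸ 1) ^ h * M + h * M ^ h ∎)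

  ^-regroup : ∀ a b g h j s → a ^ (j * g * s) * b ^ (j * h * suc s) ≡ ((a ^ g * b ^ h) ^ j) ^ s * b ^ (j * h)
  ^-regroup a b g h j s = begin
    a ^ (j * g * s) * b ^ (j * h * suc s)                    ≡⟨ cong₂ (λ x y → a ^ x * b ^ y) (exp₁ g j s) (exp₂ h j s) ⟩
    a ^ (g * (j * s)) * b ^ (h * (j * s) + j * h)            ≡⟨ cong (a ^ (g * (j * s)) *_) (^-distribˡ-+-* b (h * (j * s)) (j * h)) ⟩
    a ^ (g * (j * s)) * (b ^ (h * (j * s)) * b ^ (j * h))    ≡⟨ *-assoc (a ^ (g * (j * s))) _ _ ⟨
    a ^ (g * (j * s)) * b ^ (h * (j * s)) * b ^ (j * h)      ≡⟨ cong (_* b ^ (j * h)) (cong₂ _*_ (^-*-assoc a g (j * s)) (^-*-assoc b h (j * s))) ⟨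
    (a ^ g) ^ (j * s) * (b ^ h) ^ (j * s) * b ^ (j * h)      ≡⟨ cong (_* b ^ (j * h)) (^-distribʳ-* (a ^ g) (b ^ h) (j * s)) ⟨
    (a ^ g * b ^ h) ^ (j * s) * b ^ (j * h)                  ≡⟨ cong (_* b ^ (j * h)) (^-*-assoc (a ^ g * b ^ h) j s) ⟨
    ((a ^ g * b ^ h) ^ j) ^ s * b ^ (j * h)                  ∎
    where
    open ≡-Reasoning
    exp₁ : ∀ g j s → j * g * s ≡ g * (j * s)
    exp₁ = solve-∀
    exp₂ : ∀ h j s → j * h * suc s ≡ h * (j * s) + j * h
    exp₂ = solve-∀

  -- Once a round loses, x < y, then s rounds of j g steps lose by more than the polynomial
  -- factor Φ₀ ≤ ((s + 1) j P)^m as soon as s is large.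
  rounds-gap : ∀ a b c e g h m P s Φ₀ → let x = a ^ g * b ^ h ; j = suc (2 ^ suc m * x) in
               x < e ^ g * c ^ h → 1 ≤ x → 1 ≤ c → (j * P) ^ m * b ^ (j * h) ≤ s → Φ₀ ≤ (suc s * (j * P)) ^ m →
               a ^ (j * g * s) * Φ₀ * b ^ (j * h * suc s) < c ^ (j * h * suc s) * e ^ (j * g * s)
  rounds-gap a b c e g h m P s Φ₀ x<y 1≤x 1≤c C≤s Φ₀≤ = begin-strict
    a ^ K * Φ₀ * b ^ L                         ≡⟨ *-CS.xy∙z≈xz∙y (a ^ K) Φ₀ (b ^ L) ⟩
    a ^ K * b ^ L * Φ₀                         ≡⟨ cong (_* Φ₀) (^-regroup a b g h j s) ⟩
    X ^ s * b ^ (j * h) * Φ₀                   ≤⟨ *-monoʳ-≤ (X ^ s * b ^ (j * h)) (≤-trans Φ₀≤ (≤-reflexive (^-distribʳ-* (suc s) (j * P) m))) ⟩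
    X ^ s * b ^ (j * h) * (suc s ^ m * jP ^ m) ≡⟨ rearrange (X ^ s) (b ^ (j * h)) (suc s ^ m) (jP ^ m) ⟩
    jP ^ m * b ^ (j * h) * (suc s ^ m * X ^ s) <⟨ polynomial<exponential m X Y _ s (amplify-gap x y Z x<y) (1≤^ x j 1≤x) C≤s ⟩
    Y ^ s                                      ≤⟨ m≤m*n (Y ^ s) _ {{>-nonZero (1≤^ c (j * h) 1≤c)}} ⟩
    Y ^ s * c ^ (j * h)                        ≡⟨ ^-regroup e c g h j s ⟨
    e ^ K * c ^ L                              ≡⟨ *-comm (e ^ K) (c ^ L) ⟩
    c ^ L * e ^ K                              ∎
    where
    open ≤-Reasoning
    x y Z j jP X Y K L : ℕ
    x = a ^ g * b ^ h
    y = e ^ g * c ^ h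
    Z = 2 ^ suc m
    j = suc (Z * x)
    jP = j * P
    X = x ^ j
    Y = y ^ j
    K = j * g * s
    L = j * h * suc s
    rearrange : ∀ x b a c → x * b * (a * c) ≡ c * b * (a * x)
    rearrange = solve-∀

module IntegerVersion where

  open import Data.Bool using (true)
  open import Data.Fin.Subset using (Subset; ∣_∣)
  open import Data.List using (List; []; _∷_; length)
  open import Data.List.Membership.Propositional using (_∈_)
  open import Data.List.Relation.Unary.AllPairs using (AllPairs)
  open import Data.Nat
  open import Data.Nat.DivMod using (_/_; _%_; m/n*n≤m; m*n/n≡m; /-monoˡ-≤; m≡m%n+[m/n]*n; m%n<n)
  open import Data.Nat.Properties
  open import Data.Nat.Tactic.RingSolver using (solve-∀)
  open import Data.Product using (∃-syntax; _×_; _,_)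
  open import Relation.Binary.PropositionalEquality

  open import Defs
  open FiniteSums
  open Greedy
  open Asymptotics

  Packing : (m d B C D : ℕ) {n : ℕ} → (Subset n → TupleSet n d) → Set
  Packing m d B C D {n} f =
    ∃[ F ] (((t : Tuple n d) → t ∈ F → ∃[ S ] (∣ S ∣ ≡ m × f S t ≡ true)) ×
            D * d * length F ≤ B * n ×
            ((S : Subset n) → ∣ S ∣ ≡ m → C * n ≤ D * cardIn (f S) F) ×
            AllPairs Disjoint F)

  -- The theorem for a = A / D, b = B / D, c = C / D, under the hypothesis d (c + b²) < a b.
  module _ (m d : ℕ) .{{_ : NonZero d}} (A B C D : ℕ) .{{_ : NonZero D}} (d[c+b²]<ab : d * (C * D + B * B) < A * B) where

    -- Up to the common denominator P, at most g n / P tuples are chosen and h n / P hits are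
    -- required per set; every step produces fresh hits with density R / q.
    P g h R q : ℕ
    P = D * d * D
    g = B * D
    h = C * D * d
    R = A * P ∸ D * (d * (d * g))
    q = P * D

    1≤P : 1 ≤ P
    1≤P = >-nonZero⁻¹ P {{m*n≢0 (D * d) D {{m*n≢0 D d}}}}

    1≤q : 1 ≤ q
    1≤q = *-mono-≤ 1≤P (>-nonZero⁻¹ D)

    qh<gR : q * h < g * R
    qh<gR = begin-strict
      q * h                                      ≡⟨ regroup₁ D d C ⟩
      dD³ * (d * (C * D))                        <⟨ *-monoʳ-< dD³ {{dD³≢0}} (m+n≤o⇒m≤o∸n (suc (d * (C * D))) dCD<AB∸dBB) ⟩
      dD³ * (A * B ∸ d * (B * B))                ≡⟨ *-distribˡ-∸ dD³ (A * B) (d * (B * B)) ⟩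
      dD³ * (A * B) ∸ dD³ * (d * (B * B))        ≡⟨ cong₂ _∸_ (regroup₂ D d A B) (regroup₃ D d B) ⟩
      g * (A * P) ∸ g * (D * (d * (d * g)))      ≡⟨ *-distribˡ-∸ g (A * P) _ ⟨
      g * R                                      ∎
      where
      open ≤-Reasoning
      dD³ : ℕ
      dD³ = d * D * D * D
      dD³≢0 : NonZero dD³
      dD³≢0 = m*n≢0 (d * D * D) D {{m*n≢0 (d * D) D {{m*n≢0 d D}}}}
      dCD<AB∸dBB : suc (d * (C * D)) + d * (B * B) ≤ A * B
      dCD<AB∸dBB = subst (λ z → suc z ≤ A * B) (*-distribˡ-+ d (C * D) (B * B)) d[c+b²]<ab
      regroup₁ : ∀ D d C → D * d * D * D * (C * D * d) ≡ d * D * D * D * (d * (C * D))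
      regroup₁ = solve-∀
      regroup₂ : ∀ D d A B → d * D * D * D * (A * B) ≡ B * D * (A * (D * d * D))
      regroup₂ = solve-∀
      regroup₃ : ∀ D d B → d * D * D * D * (d * (B * B)) ≡ B * D * (D * (d * (d * (B * D))))
      regroup₃ = solve-∀

    AP≡R+D*d*d*g : A * P ≡ R + D * (d * (d * g))
    AP≡R+D*d*d*g = sym (trans (+-comm R _) (m+[n∸m]≡n D*d*d*g≤AP))
      where
      D*d*d*g≤AP : D * (d * (d * g)) ≤ A * P
      D*d*d*g≤AP = ≮⇒≥ λ AP<D*d*d*g →
        n≮0 (subst (q * h <_) (trans (cong (g *_) (m≤n⇒m∸n≡0 (<⇒≤ AP<D*d*d*g))) (*-zeroʳ g)) qh<gR)

    -- μ only has to exceed q h² and R, for E*M<[E+gR]*μ and R<E.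
    μ M E : ℕ
    μ = 2 + q * h * h + R
    M = h + μ
    E = M * q

    R<μ : R < μ
    R<μ = s≤s (≤-trans (m≤n+m R (q * h * h)) (n≤1+n _))

    1≤M∸1 : 1 ≤ M ∸ 1
    1≤M∸1 = ≤-trans (s≤s z≤n) (∸-monoˡ-≤ 1 (m≤n+m μ h))

    R<E : R < E
    R<E = <-≤-trans R<μ (≤-trans (m≤n+m μ h) (m≤m*n M q {{>-nonZero 1≤q}}))

    E*M<[E+gR]*μ : E * M < (E + g * R) * μ
    E*M<[E+gR]*μ = begin-strict
      E * M                                     ≡⟨ expand q h μ ⟩
      q * h * h + (q * h * μ + E * μ)           <⟨ +-monoˡ-< _ (≤-<-trans (m≤m+n (q * h * h) R) (n<1+n _)) ⟩
      suc (q * h * h + R) + (q * h * μ + E * μ) ≤⟨ +-monoˡ-≤ _ (≤-trans (n≤1+n _) (m≤m*n μ gR∸qh {{>-nonZero 1≤gR∸qh}})) ⟩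
      μ * gR∸qh + (q * h * μ + E * μ)           ≡⟨ collect μ gR∸qh q h E ⟩
      (E + (q * h + gR∸qh)) * μ                 ≡⟨ cong (λ x → (E + x) * μ) (m+[n∸m]≡n (<⇒≤ qh<gR)) ⟩
      (E + g * R) * μ                           ∎
      where
      open ≤-Reasoning
      gR∸qh : ℕ
      gR∸qh = g * R ∸ q * h
      1≤gR∸qh : 1 ≤ gR∸qh
      1≤gR∸qh = m<n⇒0<n∸m qh<gR
      expand : ∀ q h μ → (h + μ) * q * (h + μ) ≡ q * h * h + (q * h * μ + (h + μ) * q * μ)
      expand = solve-∀
      collect : ∀ μ δ q h E → μ * δ + (q * h * μ + E * μ) ≡ (E + (q * h + δ)) * μ
      collect = solve-∀

    x y : ℕ
    x = (E ∸ R) ^ g * M ^ h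
    y = E ^ g * (M ∸ 1) ^ h

    x<y : x < y
    x<y = ∸-^-ratio-< E R g M h μ refl (≤-trans (s≤s z≤n) R<E) E*M<[E+gR]*μ

    1≤M : 1 ≤ M
    1≤M = ≤-trans 1≤M∸1 (m∸n≤m M 1)

    1≤x : 1 ≤ x
    1≤x = *-mono-≤ (1≤^ (E ∸ R) g (m<n⇒0<n∸m R<E)) (1≤^ M h 1≤M)

    -- Rounds of j g steps, in which the ratio x / y becomes smaller than 1 / 2^(m+1).
    j jP n₀ : ℕ
    j = suc (2 ^ suc m * x)
    jP = j * P
    n₀ = jP ^ m * M ^ (j * h) * jP

    1≤jP : 1 ≤ jP
    1≤jP = *-mono-≤ {1} {j} (s≤s z≤n) 1≤P

    1≤n₀ : 1 ≤ n₀
    1≤n₀ = *-mono-≤ (*-mono-≤ (1≤^ jP m 1≤jP) (1≤^ M (j * h) 1≤M)) 1≤jP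

    instance
      jP≢0 : NonZero jP
      jP≢0 = >-nonZero 1≤jP

    module Large (n : ℕ) (n₀≤n : n₀ ≤ n) (f : Subset n → TupleSet n d)
             (dense : ∀ S → ∣ S ∣ ≡ m → A * n ^ d ≤ D * card (f S)) where

      open GreedyPacking m f
      open Potential M

      -- s rounds; K candidates in total, and L ≥ c n hits are required.
      s K L : ℕ
      s = n / jP
      K = j * g * s
      L = j * h * suc s

      0<n : 0 < n
      0<n = ≤-trans 1≤n₀ n₀≤n

      s*jP≤n : s * jP ≤ n
      s*jP≤n = m/n*n≤m n jP

      n<[1+s]*jP : n < suc s * jP
      n<[1+s]*jP = begin-strict
        n               ≡⟨ m≡m%n+[m/n]*n n jP ⟩
        n % jP + s * jP <⟨ +-monoˡ-< (s * jP) (m%n<n n jP) ⟩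
        jP + s * jP     ∎
        where open ≤-Reasoning

      C≤s : jP ^ m * M ^ (j * h) ≤ s
      C≤s = subst (_≤ s) (m*n/n≡m (jP ^ m * M ^ (j * h)) jP) (/-monoˡ-≤ jP n₀≤n)

      K*P≤g*n : K * P ≤ g * n
      K*P≤g*n = ≤-trans (≤-reflexive (regroup j g s P)) (*-monoʳ-≤ g s*jP≤n)
        where
        regroup : ∀ j g s P → j * g * s * P ≡ g * (s * (j * P))
        regroup = solve-∀

      step : ∀ σ → length σ < K → ∃[ τ ] (q * Φ (τ ∷ σ) ≤ (E ∸ R) * Φ σ)
      step σ |σ|<K = ∃-step 1≤M 0<n q R σ λ S size →
        freshHits-≥ 0<n A D P g R AP≡R+D*d*d*g S σ size (dense S size) few
        where
        few : P * length (greedy σ) ≤ g * n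
        few = ≤-trans (*-monoʳ-≤ P (≤-trans (length-greedy-≤ σ) (<⇒≤ |σ|<K))) (≤-trans (≤-reflexive (*-comm P K)) K*P≤g*n)

      module Outcome (σ : List (Tuple n d)) (|σ|≡K : length σ ≡ K) (bound : q ^ K * Φ σ ≤ (E ∸ R) ^ K * Φ []) where

        L≤hits : ∀ S → ∣ S ∣ ≡ m → L ≤ hits S (greedy σ)
        L≤hits S size = ≮⇒≥ λ hits<L → <⇒≱ gap (begin
          (M ∸ 1) ^ L * E ^ K              ≡⟨ cong ((M ∸ 1) ^ L *_) (^-distribʳ-* M q K) ⟩
          (M ∸ 1) ^ L * (M ^ K * q ^ K)    ≡⟨ *-assoc ((M ∸ 1) ^ L) (M ^ K) (q ^ K) ⟨
          (M ∸ 1) ^ L * M ^ K * q ^ K      ≤⟨ *-monoˡ-≤ (q ^ K) (subst (λ k → (M ∸ 1) ^ L * M ^ k ≤ weight S σ * M ^ L) |σ|≡K (weight-lower S σ L (<⇒≤ hits<L))) ⟩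
          weight S σ * M ^ L * q ^ K       ≤⟨ *-monoˡ-≤ (q ^ K) (*-monoˡ-≤ (M ^ L) (weight-≤-Φ S σ size)) ⟩
          Φ σ * M ^ L * q ^ K              ≡⟨ rotate (Φ σ) (M ^ L) (q ^ K) ⟩
          q ^ K * Φ σ * M ^ L              ≤⟨ *-monoˡ-≤ (M ^ L) bound ⟩
          (E ∸ R) ^ K * Φ [] * M ^ L       ∎)
          where
          open ≤-Reasoning
          rotate : ∀ a b c → a * b * c ≡ c * a * b
          rotate = solve-∀
          gap : (E ∸ R) ^ K * Φ [] * M ^ L < (M ∸ 1) ^ L * E ^ K
          gap = rounds-gap (E ∸ R) M (M ∸ 1) E g h m P s (Φ []) x<y 1≤x 1≤M∸1 C≤s
                  (≤-trans Φ-[]-≤ (^-monoˡ-≤ m (<⇒≤ n<[1+s]*jP)))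

        length-≤ : D * d * length (greedy σ) ≤ B * n
        length-≤ = begin
          D * d * length (greedy σ) ≤⟨ *-monoʳ-≤ (D * d) (length-greedy-≤ σ) ⟩
          D * d * length σ          ≡⟨ cong (D * d *_) |σ|≡K ⟩
          D * d * K                 ≡⟨ regroup D d j B s ⟩
          B * (s * jP)              ≤⟨ *-monoʳ-≤ B s*jP≤n ⟩
          B * n                     ∎
          where
          open ≤-Reasoning
          regroup : ∀ D d j B s → D * d * (j * (B * D) * s) ≡ B * (s * (j * (D * d * D)))
          regroup = solve-∀

        cardIn-≥ : ∀ S → ∣ S ∣ ≡ m → C * n ≤ D * cardIn (f S) (greedy σ)
        cardIn-≥ S size = begin
          C * n                         ≤⟨ *-monoʳ-≤ C (<⇒≤ n<[1+s]*jP) ⟩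
          C * (suc s * jP)              ≡⟨ regroup C s j D d ⟩
          D * L                         ≤⟨ *-monoʳ-≤ D (L≤hits S size) ⟩
          D * hits S (greedy σ)         ≡⟨ cong (D *_) (length-filter≡∑𝟙 (greedy σ) (f S)) ⟨
          D * cardIn (f S) (greedy σ)   ∎
          where
          open ≤-Reasoning
          regroup : ∀ C s j D d → C * (suc s * (j * (D * d * D))) ≡ D * (j * (C * D * d) * suc s)
          regroup = solve-∀

      packing-at : Packing m d B C D f
      packing-at = from-run (iterate q (E ∸ R) K step)
        where
        from-run : ∃[ σ ] (length σ ≡ K × q ^ K * Φ σ ≤ (E ∸ R) ^ K * Φ []) → Packing m d B C D f
        from-run (σ , |σ|≡K , bound) = greedy σ , greedy-good σ , length-≤ , cardIn-≥ , greedy-disjoint σ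
          where open Outcome σ |σ|≡K bound

    packing-ℕ : ∃[ n₀ ] ((n : ℕ) → n₀ ≤ n → (f : Subset n → TupleSet n d) →
                  ((S : Subset n) → ∣ S ∣ ≡ m → A * n ^ d ≤ D * card (f S)) → Packing m d B C D f)
    packing-ℕ = n₀ , Large.packing-at

module RationalScaling where

  open import Data.Integer as ℤ using (+_; -[1+_])
  import Data.Integer.Properties as ℤ
  open import Data.Nat as ℕ using (ℕ; suc)
  import Data.Nat.Properties as ℕ
  open import Data.Nat.Coprimality using (1-coprimeTo) renaming (sym to coprime-sym)
  open import Data.Rational
  open import Data.Rational.Properties
  open import Data.Rational.Solver using (module +-*-Solver)
  import Data.Rational.Unnormalised as ℚᵘ
  import Data.Rational.Unnormalised.Properties as ℚᵘ
  open import Function.Bundles using (_⇔_; mk⇔)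
  open import Data.Nat.Tactic.RingSolver using (solve-∀)
  open import Algebra.Bundles using (CommutativeMonoid)
  import Algebra.Properties.CommutativeSemigroup (CommutativeMonoid.commutativeSemigroup *-1-commutativeMonoid) as *-CS
  open import Relation.Binary.PropositionalEquality

  open import Defs

  ⟦⟧≡mkℚ : ∀ k → ⟦ k ⟧ ≡ mkℚ (+ k) 0 (coprime-sym (1-coprimeTo k))
  ⟦⟧≡mkℚ k = normalize-coprime (coprime-sym (1-coprimeTo k))

  ⟦⟧-homo-* : ∀ x y → ⟦ x ℕ.* y ⟧ ≡ ⟦ x ⟧ * ⟦ y ⟧
  ⟦⟧-homo-* x y rewrite ⟦⟧≡mkℚ x | ⟦⟧≡mkℚ y = cong (_/ 1) (ℤ.pos-* x y)

  ⟦⟧-homo-+ : ∀ x y → ⟦ x ℕ.+ y ⟧ ≡ ⟦ x ⟧ + ⟦ y ⟧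
  ⟦⟧-homo-+ x y rewrite ⟦⟧≡mkℚ x | ⟦⟧≡mkℚ y =
    cong (_/ 1) (trans (ℤ.pos-+ x y) (sym (cong₂ ℤ._+_ (ℤ.*-identityʳ (+ x)) (ℤ.*-identityʳ (+ y)))))

  ⟦⟧-mono-≤ : ∀ {x y} → x ℕ.≤ y → ⟦ x ⟧ ≤ ⟦ y ⟧
  ⟦⟧-mono-≤ {x} {y} x≤y rewrite ⟦⟧≡mkℚ x | ⟦⟧≡mkℚ y =
    *≤* (subst₂ ℤ._≤_ (sym (ℤ.*-identityʳ (+ x))) (sym (ℤ.*-identityʳ (+ y))) (ℤ.+≤+ x≤y))

  ⟦⟧-cancel-≤ : ∀ {x y} → ⟦ x ⟧ ≤ ⟦ y ⟧ → x ℕ.≤ y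
  ⟦⟧-cancel-≤ {x} {y} x≤y rewrite ⟦⟧≡mkℚ x | ⟦⟧≡mkℚ y with x≤y
  ... | *≤* x≤y = ℤ.drop‿+≤+ (subst₂ ℤ._≤_ (ℤ.*-identityʳ (+ x)) (ℤ.*-identityʳ (+ y)) x≤y)

  ⟦⟧-cancel-< : ∀ {x y} → ⟦ x ⟧ < ⟦ y ⟧ → x ℕ.< y
  ⟦⟧-cancel-< {x} {y} x<y rewrite ⟦⟧≡mkℚ x | ⟦⟧≡mkℚ y with x<y
  ... | *<* x<y = ℤ.drop‿+<+ (subst₂ ℤ._<_ (ℤ.*-identityʳ (+ x)) (ℤ.*-identityʳ (+ y)) x<y)

  ⟦⟧-nonNeg : ∀ k → NonNegative ⟦ k ⟧
  ⟦⟧-nonNeg k = subst NonNegative (sym (⟦⟧≡mkℚ k)) _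

  ⟦⟧-pos : ∀ k .{{_ : ℕ.NonZero k}} → Positive ⟦ k ⟧
  ⟦⟧-pos (suc k) = subst Positive (sym (⟦⟧≡mkℚ (suc k))) _

  *-↧-≡-↥ : ∀ p → 0ℚ < p → p * ⟦ ↧ₙ p ⟧ ≡ ⟦ ℤ.∣ ↥ p ∣ ⟧
  *-↧-≡-↥ p@(mkℚ (+ N) k c) _ rewrite ⟦⟧≡mkℚ (suc k) | ⟦⟧≡mkℚ N =
    toℚᵘ-injective (ℚᵘ.≃-trans (toℚᵘ-homo-* p (mkℚ (+ suc k) 0 (coprime-sym (1-coprimeTo (suc k))))) (ℚᵘ.*≡* (trans (ℤ.*-identityʳ _) (cong (λ z → + N ℤ.* + suc z) (sym (ℕ.*-identityʳ k))))))
  *-↧-≡-↥ (mkℚ -[1+ N ] k c) (*<* ())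

  ÷ℕ-*-cancel : ∀ q k .{{_ : ℕ.NonZero k}} → (q ÷ℕ k) * ⟦ k ⟧ ≡ q
  ÷ℕ-*-cancel q k@(suc _) = trans (*-assoc q (+ 1 / k) ⟦ k ⟧) (trans (cong (q *_) 1/k*k≡1) (*-identityʳ q))
    where
    1/k*k≡1 : (+ 1 / k) * ⟦ k ⟧ ≡ 1ℚ
    1/k*k≡1 = trans (cong (_* ⟦ k ⟧) (normalize-coprime (1-coprimeTo k))) (*-↧-≡-↥ (mkℚ (+ 1) _ (1-coprimeTo k)) (*<* (ℤ.+<+ (ℕ.s≤s ℕ.z≤n))))

  scale-≤-⇔ : ∀ {r s} D {u v} .{{_ : ℕ.NonZero D}} → r * ⟦ D ⟧ ≡ ⟦ u ⟧ → s * ⟦ D ⟧ ≡ ⟦ v ⟧ → (r ≤ s) ⇔ (u ℕ.≤ v)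
  scale-≤-⇔ D rD≡u sD≡v = mk⇔
    (λ r≤s → ⟦⟧-cancel-≤ (subst₂ _≤_ rD≡u sD≡v (*-monoʳ-≤-nonNeg ⟦ D ⟧ {{⟦⟧-nonNeg D}} r≤s)))
    (λ u≤v → *-cancelʳ-≤-pos ⟦ D ⟧ {{⟦⟧-pos D}} (subst₂ _≤_ (sym rD≡u) (sym sD≡v) (⟦⟧-mono-≤ u≤v)))

  scale-< : ∀ {r s} D {u v} .{{_ : ℕ.NonZero D}} → r * ⟦ D ⟧ ≡ ⟦ u ⟧ → s * ⟦ D ⟧ ≡ ⟦ v ⟧ → r < s → u ℕ.< v
  scale-< D rD≡u sD≡v r<s = ⟦⟧-cancel-< (subst₂ _<_ rD≡u sD≡v (*-monoˡ-<-pos ⟦ D ⟧ {{⟦⟧-pos D}} r<s))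

  *⟦⟧-scale : ∀ p D N x → p * ⟦ D ⟧ ≡ ⟦ N ⟧ → p * ⟦ x ⟧ * ⟦ D ⟧ ≡ ⟦ N ℕ.* x ⟧
  *⟦⟧-scale p D N x pD≡N = begin
    p * ⟦ x ⟧ * ⟦ D ⟧  ≡⟨ *-assoc p ⟦ x ⟧ ⟦ D ⟧ ⟩
    p * (⟦ x ⟧ * ⟦ D ⟧) ≡⟨ cong (p *_) (*-comm ⟦ x ⟧ ⟦ D ⟧) ⟩
    p * (⟦ D ⟧ * ⟦ x ⟧) ≡⟨ *-assoc p ⟦ D ⟧ ⟦ x ⟧ ⟨
    p * ⟦ D ⟧ * ⟦ x ⟧  ≡⟨ cong (_* ⟦ x ⟧) pD≡N ⟩
    ⟦ N ⟧ * ⟦ x ⟧      ≡⟨ ⟦⟧-homo-* N x ⟨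
    ⟦ N ℕ.* x ⟧        ∎
    where open ≡-Reasoning

  ⟦⟧-scale : ∀ D x → ⟦ x ⟧ * ⟦ D ⟧ ≡ ⟦ D ℕ.* x ⟧
  ⟦⟧-scale D x = trans (*-comm ⟦ x ⟧ ⟦ D ⟧) (sym (⟦⟧-homo-* D x))

  ÷ℕ-*-⟦⟧ : ∀ p D N x k .{{_ : ℕ.NonZero k}} → p * ⟦ D ⟧ ≡ ⟦ N ⟧ → ((p * ⟦ x ⟧) ÷ℕ k) * ⟦ D ℕ.* k ⟧ ≡ ⟦ N ℕ.* x ⟧
  ÷ℕ-*-⟦⟧ p D N x k pD≡N = begin
    ((p * ⟦ x ⟧) ÷ℕ k) * ⟦ D ℕ.* k ⟧       ≡⟨ cong (((p * ⟦ x ⟧) ÷ℕ k) *_) (trans (cong ⟦_⟧ (ℕ.*-comm D k)) (⟦⟧-homo-* k D)) ⟩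
    ((p * ⟦ x ⟧) ÷ℕ k) * (⟦ k ⟧ * ⟦ D ⟧)   ≡⟨ *-assoc ((p * ⟦ x ⟧) ÷ℕ k) ⟦ k ⟧ ⟦ D ⟧ ⟨
    ((p * ⟦ x ⟧) ÷ℕ k) * ⟦ k ⟧ * ⟦ D ⟧     ≡⟨ cong (_* ⟦ D ⟧) (÷ℕ-*-cancel (p * ⟦ x ⟧) k) ⟩
    p * ⟦ x ⟧ * ⟦ D ⟧                       ≡⟨ *⟦⟧-scale p D N x pD≡N ⟩
    ⟦ N ℕ.* x ⟧                             ∎
    where open ≡-Reasoning

  open +-*-Solver using (solve; _:+_; _:*_; _:-_; _:=_)

  c<2b[a/2d-b]⇒dc+2db²<ab : ∀ (a b c : ℚ) d .{{_ : ℕ.NonZero d}} → c < ⟦ 2 ⟧ * b * ((a ÷ℕ 2) ÷ℕ d - b) →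
             c * ⟦ d ⟧ + ⟦ 2 ⟧ * (⟦ d ⟧ * (b * b)) < a * b
  c<2b[a/2d-b]⇒dc+2db²<ab a b c d c<2b[a/2d-b] = begin-strict
    c * ⟦ d ⟧ + ⟦ 2 ⟧ * (⟦ d ⟧ * (b * b))                          <⟨ +-monoˡ-< _ (*-monoˡ-<-pos ⟦ d ⟧ {{⟦⟧-pos d}} c<2b[a/2d-b]) ⟩
    ⟦ 2 ⟧ * b * (u - b) * ⟦ d ⟧ + ⟦ 2 ⟧ * (⟦ d ⟧ * (b * b))      ≡⟨ expand ⟦ 2 ⟧ b u ⟦ d ⟧ ⟩
    b * (u * ⟦ d ⟧ * ⟦ 2 ⟧)                                      ≡⟨ cong (λ e → b * (e * ⟦ 2 ⟧)) (÷ℕ-*-cancel (a ÷ℕ 2) d) ⟩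
    b * ((a ÷ℕ 2) * ⟦ 2 ⟧)                                       ≡⟨ cong (b *_) (÷ℕ-*-cancel a 2) ⟩
    b * a                                                        ≡⟨ *-comm b a ⟩
    a * b                                                        ∎
    where
    open ≤-Reasoning
    u : ℚ
    u = (a ÷ℕ 2) ÷ℕ d
    expand : ∀ t b u d → t * b * (u - b) * d + t * (d * (b * b)) ≡ b * (u * d * t)
    expand = solve 4 (λ t b u d → t :* b :* (u :- b) :* d :+ t :* (d :* (b :* b)) := b :* (u :* d :* t)) refl

  module CommonDenominator (a b c : ℚ) (0<a : 0ℚ < a) (0<b : 0ℚ < b) (0<c : 0ℚ < c) where

    D A B C : ℕ
    D = ↧ₙ a ℕ.* ↧ₙ b ℕ.* ↧ₙ c
    A = ℤ.∣ ↥ a ∣ ℕ.* (↧ₙ b ℕ.* ↧ₙ c)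
    B = ℤ.∣ ↥ b ∣ ℕ.* (↧ₙ a ℕ.* ↧ₙ c)
    C = ℤ.∣ ↥ c ∣ ℕ.* (↧ₙ a ℕ.* ↧ₙ b)

    instance
      D≢0 : ℕ.NonZero D
      D≢0 = ℕ.m*n≢0 (↧ₙ a ℕ.* ↧ₙ b) (↧ₙ c) {{ℕ.m*n≢0 (↧ₙ a) (↧ₙ b)}}

    private
      extend : ∀ p {D N} k → p * ⟦ D ⟧ ≡ ⟦ N ⟧ → p * ⟦ D ℕ.* k ⟧ ≡ ⟦ N ℕ.* k ⟧
      extend p {D} {N} k pD≡N = begin
        p * ⟦ D ℕ.* k ⟧      ≡⟨ cong (p *_) (⟦⟧-homo-* D k) ⟩
        p * (⟦ D ⟧ * ⟦ k ⟧)  ≡⟨ *-assoc p ⟦ D ⟧ ⟦ k ⟧ ⟨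
        p * ⟦ D ⟧ * ⟦ k ⟧    ≡⟨ cong (_* ⟦ k ⟧) pD≡N ⟩
        ⟦ N ⟧ * ⟦ k ⟧        ≡⟨ ⟦⟧-homo-* N k ⟨
        ⟦ N ℕ.* k ⟧          ∎
        where open ≡-Reasoning

      reorder : ∀ x y z → x ℕ.* y ℕ.* z ≡ y ℕ.* (x ℕ.* z)
      reorder = solve-∀

    aD≡A : a * ⟦ D ⟧ ≡ ⟦ A ⟧
    aD≡A = subst (λ e → a * ⟦ e ⟧ ≡ ⟦ A ⟧) (sym (ℕ.*-assoc (↧ₙ a) (↧ₙ b) (↧ₙ c))) (extend a {↧ₙ a} {ℤ.∣ ↥ a ∣} (↧ₙ b ℕ.* ↧ₙ c) (*-↧-≡-↥ a 0<a))

    bD≡B : b * ⟦ D ⟧ ≡ ⟦ B ⟧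
    bD≡B = subst (λ e → b * ⟦ e ⟧ ≡ ⟦ B ⟧) (sym (reorder (↧ₙ a) (↧ₙ b) (↧ₙ c))) (extend b {↧ₙ b} {ℤ.∣ ↥ b ∣} (↧ₙ a ℕ.* ↧ₙ c) (*-↧-≡-↥ b 0<b))

    cD≡C : c * ⟦ D ⟧ ≡ ⟦ C ⟧
    cD≡C = subst (λ e → c * ⟦ e ⟧ ≡ ⟦ C ⟧) (sym (ℕ.*-comm (↧ₙ a ℕ.* ↧ₙ b) (↧ₙ c))) (extend c {↧ₙ c} {ℤ.∣ ↥ c ∣} (↧ₙ a ℕ.* ↧ₙ b) (*-↧-≡-↥ c 0<c))

    d[c+b²]<ab : ∀ d .{{_ : ℕ.NonZero d}} → c < ⟦ 2 ⟧ * b * ((a ÷ℕ 2) ÷ℕ d - b) → d ℕ.* (C ℕ.* D ℕ.+ B ℕ.* B) ℕ.< A ℕ.* B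
    d[c+b²]<ab d c<2b[a/2d-b] = ℕ.≤-trans (ℕ.s≤s d[c+b²]≤dc+2db²) (scale-< (D ℕ.* D) lhs rhs (c<2b[a/2d-b]⇒dc+2db²<ab a b c d c<2b[a/2d-b]))
      where
      d[c+b²]≤dc+2db² : d ℕ.* (C ℕ.* D ℕ.+ B ℕ.* B) ℕ.≤ d ℕ.* (C ℕ.* D) ℕ.+ 2 ℕ.* (d ℕ.* (B ℕ.* B))
      d[c+b²]≤dc+2db² = ℕ.≤-trans (ℕ.≤-reflexive (ℕ.*-distribˡ-+ d (C ℕ.* D) (B ℕ.* B))) (ℕ.+-monoʳ-≤ (d ℕ.* (C ℕ.* D)) (ℕ.m≤m+n (d ℕ.* (B ℕ.* B)) _))
      lhs : (c * ⟦ d ⟧ + ⟦ 2 ⟧ * (⟦ d ⟧ * (b * b))) * ⟦ D ℕ.* D ⟧ ≡ ⟦ d ℕ.* (C ℕ.* D) ℕ.+ 2 ℕ.* (d ℕ.* (B ℕ.* B)) ⟧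
      lhs = begin
        (c * ⟦ d ⟧ + ⟦ 2 ⟧ * (⟦ d ⟧ * (b * b))) * ⟦ D ℕ.* D ⟧
          ≡⟨ cong (λ y → (c * ⟦ d ⟧ + ⟦ 2 ⟧ * (⟦ d ⟧ * (b * b))) * y) (⟦⟧-homo-* D D) ⟩
        (c * ⟦ d ⟧ + ⟦ 2 ⟧ * (⟦ d ⟧ * (b * b))) * (⟦ D ⟧ * ⟦ D ⟧)
          ≡⟨ distribute c b ⟦ d ⟧ ⟦ 2 ⟧ ⟦ D ⟧ ⟩
        ⟦ d ⟧ * (c * ⟦ D ⟧ * ⟦ D ⟧) + ⟦ 2 ⟧ * (⟦ d ⟧ * (b * ⟦ D ⟧ * (b * ⟦ D ⟧)))
          ≡⟨ cong₂ (λ x y → ⟦ d ⟧ * (x * ⟦ D ⟧) + ⟦ 2 ⟧ * (⟦ d ⟧ * (y * y))) cD≡C bD≡B ⟩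
        ⟦ d ⟧ * (⟦ C ⟧ * ⟦ D ⟧) + ⟦ 2 ⟧ * (⟦ d ⟧ * (⟦ B ⟧ * ⟦ B ⟧))
          ≡⟨ cong₂ (λ x y → ⟦ d ⟧ * x + ⟦ 2 ⟧ * (⟦ d ⟧ * y)) (⟦⟧-homo-* C D) (⟦⟧-homo-* B B) ⟨
        ⟦ d ⟧ * ⟦ C ℕ.* D ⟧ + ⟦ 2 ⟧ * (⟦ d ⟧ * ⟦ B ℕ.* B ⟧)
          ≡⟨ cong₂ (λ x y → x + ⟦ 2 ⟧ * y) (⟦⟧-homo-* d (C ℕ.* D)) (⟦⟧-homo-* d (B ℕ.* B)) ⟨
        ⟦ d ℕ.* (C ℕ.* D) ⟧ + ⟦ 2 ⟧ * ⟦ d ℕ.* (B ℕ.* B) ⟧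
          ≡⟨ cong (λ y → ⟦ d ℕ.* (C ℕ.* D) ⟧ + y) (⟦⟧-homo-* 2 (d ℕ.* (B ℕ.* B))) ⟨
        ⟦ d ℕ.* (C ℕ.* D) ⟧ + ⟦ 2 ℕ.* (d ℕ.* (B ℕ.* B)) ⟧
          ≡⟨ ⟦⟧-homo-+ (d ℕ.* (C ℕ.* D)) _ ⟨
        ⟦ d ℕ.* (C ℕ.* D) ℕ.+ 2 ℕ.* (d ℕ.* (B ℕ.* B)) ⟧ ∎
        where
        open ≡-Reasoning
        distribute : ∀ c b d t D → (c * d + t * (d * (b * b))) * (D * D) ≡ d * (c * D * D) + t * (d * (b * D * (b * D)))
        distribute = solve 5 (λ c b d t D → (c :* d :+ t :* (d :* (b :* b))) :* (D :* D) := d :* (c :* D :* D) :+ t :* (d :* (b :* D :* (b :* D)))) refl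
      rhs : a * b * ⟦ D ℕ.* D ⟧ ≡ ⟦ A ℕ.* B ⟧
      rhs = begin
        a * b * ⟦ D ℕ.* D ⟧        ≡⟨ cong (a * b *_) (⟦⟧-homo-* D D) ⟩
        a * b * (⟦ D ⟧ * ⟦ D ⟧)    ≡⟨ *-CS.interchange a b ⟦ D ⟧ ⟦ D ⟧ ⟩
        a * ⟦ D ⟧ * (b * ⟦ D ⟧)    ≡⟨ cong₂ _*_ aD≡A bD≡B ⟩
        ⟦ A ⟧ * ⟦ B ⟧              ≡⟨ ⟦⟧-homo-* A B ⟨
        ⟦ A ℕ.* B ⟧                ∎
        where open ≡-Reasoning


open import Defs
open import Data.Nat using (ℕ; NonZero; _≥_; _^_)
open import Data.Rational using (ℚ; 0ℚ; _<_; _≤_; _*_; _-_)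
open import Data.Fin using (Fin)
open import Data.Fin.Subset using (Subset; ∣_∣)
open import Data.Vec using (lookup)
open import Data.List using (List; length) renaming (lookup to lookupL)
open import Data.List.Membership.Propositional using (_∈_)
open import Data.Bool using (true)
open import Data.Product using (Σ; _×_; ∃-syntax)
open import Relation.Binary.PropositionalEquality using (_≡_; _≢_)

open import Data.Product using (_,_)
import Data.Nat as ℕ
import Data.Nat.Properties as ℕ
open import Function.Bundles using (Equivalence)
open import Relation.Binary.PropositionalEquality using (sym)

open Greedy using (Disjoint; AllPairs-lookup)
open IntegerVersion using (Packing; packing-ℕ)
open RationalScaling

open Equivalence using (to; from)

module Rationalise (m d : ℕ) .{{_ : NonZero d}} (a b c : ℚ) (0<a : 0ℚ < a) (0<b : 0ℚ < b) (0<c : 0ℚ < c) where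

  open CommonDenominator a b c 0<a 0<b 0<c public

  density-ℕ : ∀ {n} (f : Subset n → TupleSet n d) → ((S : Subset n) → ∣ S ∣ ≡ m → a * ⟦ n ^ d ⟧ ≤ ⟦ card (f S) ⟧) →
              (S : Subset n) → ∣ S ∣ ≡ m → A ℕ.* n ^ d ℕ.≤ D ℕ.* card (f S)
  density-ℕ {n} f dense S size = to (scale-≤-⇔ D (*⟦⟧-scale a D A (n ^ d) aD≡A) (⟦⟧-scale D (card (f S)))) (dense S size)

  rationalise : ∀ {n} (f : Subset n → TupleSet n d) → Packing m d B C D f →
    ∃[ F ] (
      ((t : Tuple n d) → t ∈ F → ∃[ S ] (∣ S ∣ ≡ m × f S t ≡ true)) ×
      ⟦ length F ⟧ ≤ (b * ⟦ n ⟧) ÷ℕ d ×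
      ((S : Subset n) → ∣ S ∣ ≡ m → c * ⟦ n ⟧ ≤ ⟦ cardIn (f S) F ⟧) ×
      ((i j : Fin (length F)) → i ≢ j → (k l : Fin d) →
        lookup (lookupL F i) k ≢ lookup (lookupL F j) l))
  rationalise {n} f (F , good , short , hits , disjoint) =
    F , good ,
    from (scale-≤-⇔ (D ℕ.* d) {{ℕ.m*n≢0 D d}} (⟦⟧-scale (D ℕ.* d) (length F)) (÷ℕ-*-⟦⟧ b D B n d bD≡B)) short ,
    (λ S size → from (scale-≤-⇔ D (*⟦⟧-scale c D C n cD≡C) (⟦⟧-scale D (cardIn (f S) F))) (hits S size)) ,
    AllPairs-lookup (λ τ∩t=∅ k l τk≡tl → τ∩t=∅ l k (sym τk≡tl)) disjoint

lemma3p4 : (m d : ℕ) → .{{_ : NonZero d}} → (a b c : ℚ) →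
  0ℚ < a → 0ℚ < b → b < (a ÷ℕ 2) ÷ℕ d →
  0ℚ < c → c < ⟦ 2 ⟧ * b * ((a ÷ℕ 2) ÷ℕ d - b) →
  ∃[ n₀ ] ((n : ℕ) → n ≥ n₀ →
    (f : Subset n → TupleSet n d) →
    ((S : Subset n) → ∣ S ∣ ≡ m → a * ⟦ n ^ d ⟧ ≤ ⟦ card (f S) ⟧) →
    ∃[ F ] (
      ((t : Tuple n d) → t ∈ F → ∃[ S ] (∣ S ∣ ≡ m × f S t ≡ true)) ×
      ⟦ length F ⟧ ≤ (b * ⟦ n ⟧) ÷ℕ d ×
      ((S : Subset n) → ∣ S ∣ ≡ m → c * ⟦ n ⟧ ≤ ⟦ cardIn (f S) F ⟧) ×
      ((i j : Fin (length F)) → i ≢ j → (k l : Fin d) →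
        lookup (lookupL F i) k ≢ lookup (lookupL F j) l)))
lemma3p4 m d a b c 0<a 0<b _ 0<c c<2b[a/2d-b] =
  let (n₀ , packing) = packing-ℕ m d A B C D (d[c+b²]<ab d c<2b[a/2d-b])
  in n₀ , λ n n≥n₀ f dense → rationalise f (packing n n≥n₀ f (density-ℕ f dense))
  where open Rationalise m d a b c 0<a 0<b 0<c
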